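{- Let $r\ge 3$ and $p,q\ge0$ be integers with $p+q\ge1$, and let $s=p+q+2$. Then $\mathrm{degree}(\mathrm{Av}(\alpha_r,\beta_{pq}))\ge (r-1)(s-2)-1$.
   Context: $\alpha_r=12\cdots r$. $\beta_{pq}=\lambda\,(q+1)\,(q+2)\,\mu$ of length $p+q+2$, where $\lambda=(p+q+2)(p+q+1)\cdots(q+3)$ (length $p$) and $\mu=q(q-1)\cdots1$ (length $q$). $\mathrm{Av}(\alpha,\beta)$ is the set of permutations avoiding $\alpha$ and $\beta$; this class has polynomial growth, and the number of its permutations of length $n$ equals a polynomial in $n$ for all sufficiently large $n$; $\mathrm{degree}$ denotes the degree of that polynomial. -}

module Defs where

open import Data.Nat using (ℕ; zero; suc; _+_; _∸_)
open import Data.Fin as F using (Fin; toℕ)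
open import Data.Vec using (Vec; lookup)
open import Data.List using (List; []; _∷_; length)
open import Data.List.Relation.Unary.Unique.Propositional using (Unique)
open import Data.List.Membership.Propositional using (_∈_)
open import Data.Maybe using (Maybe; just; nothing; fromMaybe)
open import Data.Product using (_×_; ∃)
open import Data.Integer using (+_)
open import Data.Rational as Q using (ℚ; _/_)
open import Data.Rational.Properties as QP using ()
open import Data.Nat using (_≟_)
open import Relation.Nullary using (¬_; yes; no)
open import Relation.Binary.PropositionalEquality using (_≡_)
open import Function.Bundles using (_⇔_)

-- Permutations of length n : one-line notation as a vector of values in
-- Fin n (i.e. values 0..n-1, standing for 1..n) with pairwise distinct
-- entries.

IsPerm : ∀ {n} → Vec (Fin n) n → Set
IsPerm {n} v = ∀ (i j : Fin n) → lookup v i ≡ lookup v j → i ≡ j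

Contains : ∀ {n k} → Vec (Fin n) n → (Fin k → ℕ) → Set
Contains {n} {k} π τ =
  ∃ λ (e : Fin k → Fin n) →
    (∀ i j → i F.< j → e i F.< e j) ×
    (∀ i j → (τ i Data.Nat.< τ j) ⇔ (lookup π (e i) F.< lookup π (e j)))
  where import Data.Nat

Avoids : ∀ {n k} → Vec (Fin n) n → (Fin k → ℕ) → Set
Avoids π τ = ¬ Contains π τ

α : (r : ℕ) → Fin r → ℕ
α r i = suc (toℕ i)

-- β_pq = λ (q+1)(q+2) μ with λ = (p+q+2)(p+q+1)⋯(q+3), μ = q(q-1)⋯1.
-- At 0-based position i: q+1 if i = p, q+2 if i = p+1, else (p+q+2) - i.
β : (p q : ℕ) → Fin (p + q + 2) → ℕ
β p q i with toℕ i ≟ p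
... | yes _ = suc q
... | no _ with toℕ i ≟ suc p
...   | yes _ = suc (suc q)
...   | no _ = (p + q + 2) ∸ toℕ i

Enumerates : ∀ {n k l} → (Fin k → ℕ) → (Fin l → ℕ) →
             List (Vec (Fin n) n) → Set
Enumerates {n} a b L =
  Unique L × (∀ (π : Vec (Fin n) n) → (π ∈ L) ⇔ (IsPerm π × Avoids π a × Avoids π b))

-- Univariate polynomials over ℚ as coefficient lists c₀ ∷ c₁ ∷ … (lowest
-- degree first).

eval : List ℚ → ℕ → ℚ
eval [] x = Q.0ℚ
eval (c ∷ cs) x = c Q.+ ((+ x / 1) Q.* eval cs x)

degree? : List ℚ → Maybe ℕ
degree? [] = nothing
degree? (c ∷ cs) with degree? cs
... | just d = just (suc d)
... | nothing with c QP.≟ Q.0ℚ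
...   | yes _ = nothing
...   | no _ = just 0

-- degree, with the convention degree 0 = 0
degree : List ℚ → ℕ
degree P = fromMaybe 0 (degree? P)

{-# OPTIONS --safe #-}
-- Write r = K + 2. A letter is a cell or a point of a grid with K + 1 columns. The letters of the
-- grid with p rows, each cell repeated a chosen positive number of times, are followed by those of
-- the grid with q rows in reverse order, and the permutation is the standardisation of this word in
-- which a repeated letter forms a decreasing run. Along an increasing subsequence the column strictly
-- increases, so 12⋯r is avoided. In an occurrence of β the entries of λ (or, symmetrically, of μ)
-- would all be points with strictly monotone rows, but there are fewer rows than entries, so β is
-- avoided. The repetition counts can be read off the permutation, because the end of every run is
-- marked by an ascent or by an earlier letter of intermediate value. With the total number of
-- repetitions fixed, the D = (K + 1)(p + q) - 1 free counts ranging over 1..m give m ^ D distinct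
-- permutations of a length n linear in m, whereas a polynomial of degree below D grows more slowly.

module Submission where

open import Defs
open import Data.Empty using (⊥; ⊥-elim)
open import Data.Fin as Fin using (Fin; toℕ; fromℕ<; remQuot; combine)
import Data.Fin.Properties as Fin
open import Data.Integer as ℤ using (+_)
import Data.Integer.Properties as ℤ
open import Data.List as List using (List; []; _∷_; _++_; map; replicate; reverse; length; filter; allFin; take; drop)
open import Data.List.Membership.Propositional using (_∈_)
open import Data.List.Membership.Propositional.Properties using (∈-++⁺ˡ; ∈-++⁺ʳ; ∈-++⁻; ∈-allFin)
open import Data.List.Properties
  using (length-++; length-map; length-replicate; length-reverse; length-tabulate; length-take; length-drop;
         ++-assoc; map-++; map-∘; unfold-reverse; reverse-++; reverse-map; reverse-involutive;
         filter-++; filter-none; take++drop≡id; ∷ʳ-injectiveˡ; ∷-injective)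
open import Data.List.Relation.Unary.All as All using (All; []; _∷_)
import Data.List.Relation.Unary.All.Properties as All
open import Data.List.Relation.Unary.AllPairs using (AllPairs; []; _∷_)
import Data.List.Relation.Unary.AllPairs.Properties as AllPairs
open import Data.List.Relation.Unary.Any using (here; there; index)
import Data.List.Relation.Unary.Any.Properties as Any
open import Data.Maybe using (Maybe; just; nothing)
open import Data.Nat using (ℕ; zero; suc; _+_; _*_; _∸_; _^_; _≤_; _<_; _>_; z≤n; s≤s; >-nonZero)
open import Data.Nat.Coprimality using (1-coprimeTo)
import Data.Nat.Coprimality as Coprime
open import Data.Nat.ListAction using (sum)
open import Data.Nat.ListAction.Properties using (sum-++)
import Data.Nat.Properties as ℕ
import Algebra.Properties.CommutativeSemigroup ℕ.+-commutativeSemigroup as +-CS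
import Algebra.Properties.CommutativeSemigroup ℕ.*-commutativeSemigroup as *-CS
open import Data.Product using (_×_; _,_; proj₁; proj₂; ∃; ∃-syntax)
open import Data.Product.Relation.Binary.Lex.Strict using (×-Lex; ×-isStrictTotalOrder)
open import Data.Product.Relation.Binary.Pointwise.NonDependent using (≡×≡⇒≡)
open import Data.Rational as ℚ using (ℚ; _/_; mkℚ; ∣_∣; ↥_; *≤*)
import Data.Rational.Properties as ℚ
open import Data.Sum using (_⊎_; inj₁; inj₂; reduce; [_,_]′; swap)
open import Data.Sum.Properties using (swap-involutive)
open import Data.Sum.Relation.Binary.LeftOrder using (_⊎-<_; ₁∼₂; ₁∼₁; ₂∼₂; ⊎-<-isStrictTotalOrder)
open import Data.Sum.Relation.Binary.Pointwise using (Pointwise-≡⇒≡)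
open import Data.Unit using (⊤; tt)
open import Data.Vec using (Vec; lookup; tabulate)
open import Data.Vec.Properties using (lookup∘tabulate)
open import Function using (_∘_; _on_; flip)
open import Function.Bundles using (_⇔_; Equivalence)
open import Level using (0ℓ)
open import Relation.Binary.Core using (Rel)
open import Relation.Binary.Definitions using (Trichotomous; tri<; tri≈; tri>)
open import Relation.Binary.PropositionalEquality
  using (_≡_; _≢_; refl; sym; trans; cong; cong₂; subst; subst₂; isEquivalence; module ≡-Reasoning)
open import Relation.Binary.Structures using (IsStrictTotalOrder)
open import Relation.Binary.Structures.Biased using (isStrictTotalOrderᶜ)
import Relation.Binary.Construct.Flip.EqAndOrd as Flip
import Relation.Binary.Construct.On as On
open import Relation.Nullary using (¬_; ¬?; Dec; yes; no)

isStrictTotalOrder-≡ : ∀ {A : Set} {_≈_ _<_ : Rel A 0ℓ} → (∀ {x y} → x ≈ y → x ≡ y) →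
                       IsStrictTotalOrder _≈_ _<_ → IsStrictTotalOrder _≡_ _<_
isStrictTotalOrder-≡ {_<_ = _<_} ≈⇒≡ sto =
  isStrictTotalOrderᶜ record { isEquivalence = isEquivalence ; trans = S.trans ; compare = compare }
  where
  module S = IsStrictTotalOrder sto
  compare : Trichotomous _≡_ _<_
  compare x y with S.compare x y
  ... | tri< a ¬b ¬c = tri< a (¬b ∘ S.Eq.reflexive) ¬c
  ... | tri≈ ¬a b ¬c = tri≈ ¬a (≈⇒≡ b) ¬c
  ... | tri> ¬a ¬b c = tri> ¬a (¬b ∘ S.Eq.reflexive) c

>-isStrictTotalOrder : IsStrictTotalOrder _≡_ _>_
>-isStrictTotalOrder = Flip.isStrictTotalOrder ℕ.<-isStrictTotalOrder

×-Lex-isStrictTotalOrder : ∀ {A B : Set} {_<₁_ : Rel A 0ℓ} {_<₂_ : Rel B 0ℓ} →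
  IsStrictTotalOrder _≡_ _<₁_ → IsStrictTotalOrder _≡_ _<₂_ →
  IsStrictTotalOrder _≡_ (×-Lex _≡_ _<₁_ _<₂_)
×-Lex-isStrictTotalOrder sto₁ sto₂ = isStrictTotalOrder-≡ ≡×≡⇒≡ (×-isStrictTotalOrder sto₁ sto₂)

on-isStrictTotalOrder : ∀ {A B : Set} {_<_ : Rel B 0ℓ} (f : A → B) → (∀ {x y} → f x ≡ f y → x ≡ y) →
  IsStrictTotalOrder _≡_ _<_ → IsStrictTotalOrder _≡_ (_<_ on f)
on-isStrictTotalOrder f f-injective sto = isStrictTotalOrder-≡ f-injective (On.isStrictTotalOrder f sto)

lookupOr : ∀ {A : Set} → A → List A → ℕ → A
lookupOr d [] i = d
lookupOr d (x ∷ xs) zero = x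
lookupOr d (x ∷ xs) (suc i) = lookupOr d xs i

module _ {A : Set} (d : A) where

  lookupOr-++ˡ : ∀ xs ys {i} → i < length xs → lookupOr d (xs ++ ys) i ≡ lookupOr d xs i
  lookupOr-++ˡ (x ∷ xs) ys {zero} _ = refl
  lookupOr-++ˡ (x ∷ xs) ys {suc i} (s≤s i<) = lookupOr-++ˡ xs ys i<

  lookupOr-++ʳ : ∀ xs ys i → lookupOr d (xs ++ ys) (length xs + i) ≡ lookupOr d ys i
  lookupOr-++ʳ [] ys i = refl
  lookupOr-++ʳ (x ∷ xs) ys i = lookupOr-++ʳ xs ys i

  lookupOr-replicate : ∀ m {a : A} ys {i} → i < m → lookupOr d (replicate m a ++ ys) i ≡ a
  lookupOr-replicate (suc m) ys {zero} _ = refl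
  lookupOr-replicate (suc m) ys {suc i} (s≤s i<m) = lookupOr-replicate m ys i<m

  lookupOr-∈ : ∀ xs {i} → i < length xs → lookupOr d xs i ∈ xs
  lookupOr-∈ (x ∷ xs) {zero} _ = here refl
  lookupOr-∈ (x ∷ xs) {suc i} (s≤s i<) = there (lookupOr-∈ xs i<)

  lookupOr-AllPairs : ∀ {R : A → A → Set} {xs} → AllPairs R xs → ∀ {i j} → i < j → j < length xs →
    R (lookupOr d xs i) (lookupOr d xs j)
  lookupOr-AllPairs {xs = x ∷ xs} (Rx ∷ _) {zero} {suc j} _ (s≤s j<) = All.lookup Rx (lookupOr-∈ xs j<)
  lookupOr-AllPairs {xs = x ∷ xs} (_ ∷ Rxs) {suc i} {suc j} (s≤s i<j) (s≤s j<) = lookupOr-AllPairs Rxs i<j j<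

lookupOr-map : ∀ {A B : Set} (f : A → B) d xs i → lookupOr (f d) (map f xs) i ≡ f (lookupOr d xs i)
lookupOr-map f d [] i = refl
lookupOr-map f d (x ∷ xs) zero = refl
lookupOr-map f d (x ∷ xs) (suc i) = lookupOr-map f d xs i

lookupOr-default : ∀ {A : Set} (d d' : A) xs {i} → i < length xs → lookupOr d xs i ≡ lookupOr d' xs i
lookupOr-default d d' (x ∷ xs) {zero} _ = refl
lookupOr-default d d' (x ∷ xs) {suc i} (s≤s i<) = lookupOr-default d d' xs i<

AllPairs-reverse : ∀ {A : Set} {R : A → A → Set} {xs} → AllPairs R xs → AllPairs (flip R) (reverse xs)
AllPairs-reverse {xs = []} [] = []
AllPairs-reverse {xs = x ∷ xs} (Rx ∷ Rxs) rewrite unfold-reverse x xs =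
  AllPairs.++⁺ (AllPairs-reverse Rxs) ([] ∷ []) (All.tabulate λ y∈ → All.lookup Rx (Any.reverse⁻ y∈) ∷ [])

lookupOr-index : ∀ {A : Set} (d : A) {x} xs → x ∈ xs → ∃[ i ] i < length xs × lookupOr d xs i ≡ x
lookupOr-index d (y ∷ xs) (here refl) = 0 , s≤s z≤n , refl
lookupOr-index d (y ∷ xs) (there x∈) with lookupOr-index d xs x∈
... | i , i< , eq = suc i , s≤s i< , eq

lookupOr-reverse : ∀ {A : Set} (d : A) xs {i} → i < length xs → lookupOr d (reverse xs) i ≡ lookupOr d xs (length xs ∸ suc i)
lookupOr-reverse d (x ∷ xs) {i} i< rewrite unfold-reverse x xs with ℕ.m≤n⇒m<n∨m≡n (ℕ.≤-pred i<)
... | inj₁ i<xs = begin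
  lookupOr d (reverse xs ++ x ∷ []) i   ≡⟨ lookupOr-++ˡ d (reverse xs) (x ∷ []) (subst (i <_) (sym (length-reverse xs)) i<xs) ⟩
  lookupOr d (reverse xs) i             ≡⟨ lookupOr-reverse d xs i<xs ⟩
  lookupOr d xs (length xs ∸ suc i)     ≡⟨ cong (lookupOr d (x ∷ xs)) (sym (ℕ.+-∸-assoc 1 i<xs)) ⟩
  lookupOr d (x ∷ xs) (length xs ∸ i)   ∎
  where open ≡-Reasoning
... | inj₂ refl = begin
  lookupOr d (reverse xs ++ x ∷ []) (length xs)                 ≡⟨ cong (lookupOr d (reverse xs ++ x ∷ [])) length-xs ⟩
  lookupOr d (reverse xs ++ x ∷ []) (length (reverse xs) + 0)   ≡⟨ lookupOr-++ʳ d (reverse xs) (x ∷ []) 0 ⟩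
  x                                                             ≡⟨ cong (lookupOr d (x ∷ xs)) (sym (ℕ.n∸n≡0 (length xs))) ⟩
  lookupOr d (x ∷ xs) (length xs ∸ length xs)                   ∎
  where
  open ≡-Reasoning
  length-xs : length xs ≡ length (reverse xs) + 0
  length-xs = sym (trans (ℕ.+-identityʳ _) (length-reverse xs))

predecessor : ∀ {m} → 0 < m → ∃[ m' ] suc m' ≡ m
predecessor {suc m'} _ = m' , refl

ascending⇒≥index : ∀ {k} (f : ∀ i → i < k → ℕ) →
  (∀ i (i< : i < k) (si< : suc i < k) → f i i< < f (suc i) si<) → ∀ i (i< : i < k) → i ≤ f i i<
ascending⇒≥index f step zero i< = z≤n
ascending⇒≥index f step (suc i) si< =
  ℕ.≤-trans (s≤s (ascending⇒≥index f step i i<)) (step i i< si<)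
  where i< = ℕ.<-trans (ℕ.n<1+n i) si<

descending⇒≥distance : ∀ {k} (f : ∀ i → i < k → ℕ) →
  (∀ i (i< : i < k) (si< : suc i < k) → f (suc i) si< < f i i<) →
  ∀ d i (i< : i < k) → suc (i + d) ≡ k → d ≤ f i i<
descending⇒≥distance f step zero i i< _ = z≤n
descending⇒≥distance {k} f step (suc d) i i< i+d≡k =
  ℕ.≤-trans (s≤s (descending⇒≥distance f step d (suc i) si< (trans (cong suc (sym (ℕ.+-suc i d))) i+d≡k))) (step i i< si<)
  where
  si< : suc i < k
  si< = subst (suc i <_) i+d≡k (s≤s (subst (suc i ≤_) (sym (ℕ.+-suc i d)) (s≤s (ℕ.m≤m+n i d))))

*-^-distrib : ∀ a b k → (a * b) ^ k ≡ a ^ k * b ^ k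
*-^-distrib a b zero = refl
*-^-distrib a b (suc k) = trans (cong ((a * b) *_) (*-^-distrib a b k)) (*-CS.interchange a b (a ^ k) (b ^ k))

-- Standardisation

module Standardisation {n : ℕ} (_≺_ : Rel (Fin n) 0ℓ) (sto : IsStrictTotalOrder _≡_ _≺_) where
  open IsStrictTotalOrder sto using (_<?_; compare; irrefl) renaming (trans to ≺-trans)

  countBelow : List (Fin n) → Fin n → ℕ
  countBelow [] x = 0
  countBelow (y ∷ ys) x with y <? x
  ... | yes _ = suc (countBelow ys x)
  ... | no _ = countBelow ys x

  countBelow≤length : ∀ ys x → countBelow ys x ≤ length ys
  countBelow≤length [] x = z≤n
  countBelow≤length (y ∷ ys) x with y <? x
  ... | yes _ = s≤s (countBelow≤length ys x)
  ... | no _ = ℕ.m≤n⇒m≤1+n (countBelow≤length ys x)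

  countBelow<length : ∀ ys x → x ∈ ys → countBelow ys x < length ys
  countBelow<length (y ∷ ys) x (here refl) with y <? x
  ... | yes y≺y = ⊥-elim (irrefl refl y≺y)
  ... | no _ = s≤s (countBelow≤length ys x)
  countBelow<length (y ∷ ys) x (there x∈ys) with y <? x
  ... | yes _ = s≤s (countBelow<length ys x x∈ys)
  ... | no _ = ℕ.m≤n⇒m≤1+n (countBelow<length ys x x∈ys)

  countBelow-mono : ∀ ys {x y} → x ≺ y → countBelow ys x ≤ countBelow ys y
  countBelow-mono [] x≺y = z≤n
  countBelow-mono (z ∷ ys) {x} {y} x≺y with z <? x | z <? y
  ... | yes _ | yes _ = s≤s (countBelow-mono ys x≺y)
  ... | yes z≺x | no z⊀y = ⊥-elim (z⊀y (≺-trans z≺x x≺y))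
  ... | no _ | yes _ = ℕ.m≤n⇒m≤1+n (countBelow-mono ys x≺y)
  ... | no _ | no _ = countBelow-mono ys x≺y

  countBelow-strictMono : ∀ ys {x y} → x ≺ y → x ∈ ys → countBelow ys x < countBelow ys y
  countBelow-strictMono (z ∷ ys) {x} {y} x≺y x∈ with z <? x | z <? y
  countBelow-strictMono (z ∷ ys) x≺y x∈ | yes z≺x | no z⊀y = ⊥-elim (z⊀y (≺-trans z≺x x≺y))
  countBelow-strictMono (z ∷ ys) x≺y (here refl) | yes x≺x | _ = ⊥-elim (irrefl refl x≺x)
  countBelow-strictMono (z ∷ ys) x≺y (here refl) | no _ | yes _ = s≤s (countBelow-mono ys x≺y)
  countBelow-strictMono (z ∷ ys) x≺y (here refl) | no _ | no x⊀y = ⊥-elim (x⊀y x≺y)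
  countBelow-strictMono (z ∷ ys) x≺y (there x∈) | yes _ | yes _ = s≤s (countBelow-strictMono ys x≺y x∈)
  countBelow-strictMono (z ∷ ys) x≺y (there x∈) | no _ | yes _ = ℕ.m≤n⇒m≤1+n (countBelow-strictMono ys x≺y x∈)
  countBelow-strictMono (z ∷ ys) x≺y (there x∈) | no _ | no _ = countBelow-strictMono ys x≺y x∈

  rank : Fin n → ℕ
  rank = countBelow (allFin n)

  rank<n : ∀ x → rank x < n
  rank<n x = subst (rank x <_) (length-tabulate (λ i → i)) (countBelow<length (allFin n) x (∈-allFin x))

  rank-strictMono : ∀ {x y} → x ≺ y → rank x < rank y
  rank-strictMono {x} x≺y = countBelow-strictMono (allFin n) x≺y (∈-allFin x)

  rank-reflects : ∀ {x y} → rank x < rank y → x ≺ y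
  rank-reflects {x} {y} r with compare x y
  ... | tri< x≺y _ _ = x≺y
  ... | tri≈ _ refl _ = ⊥-elim (ℕ.<-irrefl refl r)
  ... | tri> _ _ y≺x = ⊥-elim (ℕ.<-asym r (rank-strictMono y≺x))

  rank-injective : ∀ {x y} → rank x ≡ rank y → x ≡ y
  rank-injective {x} {y} e with compare x y
  ... | tri< x≺y _ _ = ⊥-elim (ℕ.<-irrefl e (rank-strictMono x≺y))
  ... | tri≈ _ x≡y _ = x≡y
  ... | tri> _ _ y≺x = ⊥-elim (ℕ.<-irrefl (sym e) (rank-strictMono y≺x))

  opaque
    standardisation : Vec (Fin n) n
    standardisation = tabulate (λ x → fromℕ< (rank<n x))

    toℕ-standardisation : ∀ x → toℕ (lookup standardisation x) ≡ rank x
    toℕ-standardisation x = trans (cong toℕ (lookup∘tabulate _ x)) (Fin.toℕ-fromℕ< (rank<n x))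

  standardisation-isPerm : IsPerm standardisation
  standardisation-isPerm i j e =
    rank-injective (trans (sym (toℕ-standardisation i)) (trans (cong toℕ e) (toℕ-standardisation j)))

  standardisation-< : ∀ {i j} → i ≺ j → toℕ (lookup standardisation i) < toℕ (lookup standardisation j)
  standardisation-< {i} {j} i≺j
    rewrite toℕ-standardisation i | toℕ-standardisation j = rank-strictMono i≺j

  standardisation-<⁻ : ∀ {i j} → toℕ (lookup standardisation i) < toℕ (lookup standardisation j) → i ≺ j
  standardisation-<⁻ {i} {j} lt
    rewrite toℕ-standardisation i | toℕ-standardisation j = rank-reflects lt

-- The letters of one side, in a grid with columns 0..K: cells (repeated in a word) and points
-- (occurring once). lowCell t is the cell of column 0 and cell j t that of column j + 1 in row t;
-- point j t is the point of column j and topPoint t that of column K in row t.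
data Letter : Set where
  lowCell  : ℕ → Letter
  point    : ℕ → ℕ → Letter
  cell     : ℕ → ℕ → Letter
  topPoint : ℕ → Letter

IsCell IsPoint : Letter → Set
IsCell (lowCell _) = ⊤
IsCell (cell _ _) = ⊤
IsCell (point _ _) = ⊥
IsCell (topPoint _) = ⊥
IsPoint a = ¬ IsCell a

isCell? : ∀ a → Dec (IsCell a)
isCell? (lowCell _) = yes tt
isCell? (cell _ _) = yes tt
isCell? (point _ _) = no λ ()
isCell? (topPoint _) = no λ ()

valueKey : Letter → ℕ × ℕ × ℕ × ℕ
valueKey (lowCell t) = 0 , 0 , t , 0
valueKey (point j t) = 1 , j , t , 0
valueKey (cell j t) = 1 , j , t , 1
valueKey (topPoint t) = 2 , 0 , t , 0

valueKey-injective : ∀ {a b} → valueKey a ≡ valueKey b → a ≡ b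
valueKey-injective {lowCell _} {lowCell _} refl = refl
valueKey-injective {point _ _} {point _ _} refl = refl
valueKey-injective {cell _ _} {cell _ _} refl = refl
valueKey-injective {topPoint _} {topPoint _} refl = refl

infix 4 _<ᵥ_ _⊏_ _⊑_

_<ᵥ_ : Letter → Letter → Set
_<ᵥ_ = ×-Lex _≡_ _<_ (×-Lex _≡_ _<_ (×-Lex _≡_ _>_ _<_)) on valueKey

<ᵥ-isStrictTotalOrder : IsStrictTotalOrder _≡_ _<ᵥ_
<ᵥ-isStrictTotalOrder = on-isStrictTotalOrder valueKey valueKey-injective
  (×-Lex-isStrictTotalOrder ℕ.<-isStrictTotalOrder (×-Lex-isStrictTotalOrder ℕ.<-isStrictTotalOrder
    (×-Lex-isStrictTotalOrder >-isStrictTotalOrder ℕ.<-isStrictTotalOrder)))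

positionKey : Letter → ℕ × ℕ × ℕ
positionKey (point j t) = 0 , j , t
positionKey (lowCell t) = 1 , t , 0
positionKey (topPoint t) = 1 , t , 1
positionKey (cell j t) = 2 , j , t

_⊏_ : Letter → Letter → Set
_⊏_ = ×-Lex _≡_ _<_ (×-Lex _≡_ _<_ _<_) on positionKey

⊏-irrefl : ∀ {a} → ¬ a ⊏ a
⊏-irrefl {a} = IsStrictTotalOrder.irrefl
  (×-Lex-isStrictTotalOrder ℕ.<-isStrictTotalOrder (×-Lex-isStrictTotalOrder ℕ.<-isStrictTotalOrder ℕ.<-isStrictTotalOrder))
  {positionKey a} refl

_⊑_ : Letter → Letter → Set
a ⊑ b = a ⊏ b ⊎ (a ≡ b × IsCell a)

⊑-point-irrefl : ∀ {a} → IsPoint a → ¬ a ⊑ a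
⊑-point-irrefl {a} pt (inj₁ a⊏a) = ⊏-irrefl {a} a⊏a
⊑-point-irrefl pt (inj₂ (_ , c)) = pt c

column : ℕ → Letter → ℕ
column K (lowCell _) = 0
column K (point j _) = j
column K (cell j _) = suc j
column K (topPoint _) = K

height : Letter → ℕ
height (point _ t) = t
height (topPoint t) = t
height (lowCell _) = 0
height (cell _ _) = 0

Fits : ℕ → ℕ → Letter → Set
Fits K p (lowCell t) = t < p
Fits K p (point j t) = j < K × suc t < p
Fits K p (cell j t) = j < K × t < p
Fits K p (topPoint t) = suc t < p

column≤ : ∀ {K p} a → Fits K p a → column K a ≤ K
column≤ (lowCell t) _ = z≤n
column≤ (point j t) (j<K , _) = ℕ.<⇒≤ j<K
column≤ (cell j t) (j<K , _) = j<K
column≤ (topPoint t) _ = ℕ.≤-refl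

suc-height< : ∀ {K p} a → IsPoint a → Fits K p a → suc (height a) < p
suc-height< (lowCell t) pt _ = ⊥-elim (pt tt)
suc-height< (point j t) _ (_ , t<p) = t<p
suc-height< (cell j t) pt _ = ⊥-elim (pt tt)
suc-height< (topPoint t) _ t<p = t<p

Fits⇒0<p : ∀ {K p} a → Fits K p a → 0 < p
Fits⇒0<p (lowCell t) t<p = ℕ.≤-trans (s≤s z≤n) t<p
Fits⇒0<p (point j t) (_ , t<p) = ℕ.≤-trans (s≤s z≤n) t<p
Fits⇒0<p (cell j t) (_ , t<p) = ℕ.≤-trans (s≤s z≤n) t<p
Fits⇒0<p (topPoint t) t<p = ℕ.≤-trans (s≤s z≤n) t<p

<ᵥ-lowCell : ∀ {c t} → c <ᵥ lowCell t → ∃[ t' ] c ≡ lowCell t' × t < t'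
<ᵥ-lowCell {lowCell t'} (inj₂ (refl , inj₂ (refl , inj₁ t<t'))) = t' , refl , t<t'
<ᵥ-lowCell {lowCell t'} (inj₂ (refl , inj₂ (refl , inj₂ (refl , ()))))
<ᵥ-lowCell {lowCell t'} (inj₂ (refl , inj₁ ()))
<ᵥ-lowCell {lowCell t'} (inj₁ ())
<ᵥ-lowCell {point _ _} (inj₁ ())
<ᵥ-lowCell {point _ _} (inj₂ (() , _))
<ᵥ-lowCell {cell _ _} (inj₁ ())
<ᵥ-lowCell {cell _ _} (inj₂ (() , _))
<ᵥ-lowCell {topPoint _} (inj₁ ())
<ᵥ-lowCell {topPoint _} (inj₂ (() , _))

topPoint-<ᵥ : ∀ {t b} → topPoint t <ᵥ b → ∃[ t' ] b ≡ topPoint t' × t' < t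
topPoint-<ᵥ {b = topPoint t'} (inj₂ (refl , inj₂ (refl , inj₁ t'<t))) = t' , refl , t'<t
topPoint-<ᵥ {b = topPoint t'} (inj₂ (refl , inj₂ (refl , inj₂ (refl , ()))))
topPoint-<ᵥ {b = topPoint t'} (inj₂ (refl , inj₁ ()))
topPoint-<ᵥ {b = topPoint t'} (inj₁ (s≤s (s≤s ())))
topPoint-<ᵥ {b = lowCell _} (inj₁ ())
topPoint-<ᵥ {b = lowCell _} (inj₂ (() , _))
topPoint-<ᵥ {b = point _ _} (inj₁ (s≤s ()))
topPoint-<ᵥ {b = point _ _} (inj₂ (() , _))
topPoint-<ᵥ {b = cell _ _} (inj₁ (s≤s ()))
topPoint-<ᵥ {b = cell _ _} (inj₂ (() , _))

cell-<ᵥ-cell : ∀ {j t j' t'} → cell j t <ᵥ cell j' t' → j ≤ j'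
cell-<ᵥ-cell (inj₁ (s≤s ()))
cell-<ᵥ-cell (inj₂ (refl , inj₁ j<j')) = ℕ.<⇒≤ j<j'
cell-<ᵥ-cell (inj₂ (refl , inj₂ (refl , _))) = ℕ.≤-refl

⊑-lowCell : ∀ {b t} → b ⊑ lowCell t → ∃[ t' ] b ≡ lowCell t' × t' ≤ t ⊎ IsPoint b
⊑-lowCell {lowCell t'} (inj₁ (inj₁ (s≤s ())))
⊑-lowCell {lowCell t'} (inj₁ (inj₂ (refl , inj₁ t'<t))) = inj₁ (t' , refl , ℕ.<⇒≤ t'<t)
⊑-lowCell {lowCell t'} (inj₁ (inj₂ (refl , inj₂ (refl , ()))))
⊑-lowCell {lowCell t'} (inj₂ (refl , _)) = inj₁ (t' , refl , ℕ.≤-refl)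
⊑-lowCell {point _ _} _ = inj₂ λ ()
⊑-lowCell {topPoint _} _ = inj₂ λ ()
⊑-lowCell {cell _ _} (inj₁ (inj₁ (s≤s ())))
⊑-lowCell {cell _ _} (inj₁ (inj₂ (() , _)))
⊑-lowCell {cell _ _} (inj₂ (() , _))

⊑-cell : ∀ {j t b} → cell j t ⊑ b → ∃[ j' ] ∃[ t' ] b ≡ cell j' t' × j ≤ j'
⊑-cell {b = cell j' t'} (inj₁ (inj₁ (s≤s (s≤s ()))))
⊑-cell {b = cell j' t'} (inj₁ (inj₂ (refl , inj₁ j<j'))) = j' , t' , refl , ℕ.<⇒≤ j<j'
⊑-cell {b = cell j' t'} (inj₁ (inj₂ (refl , inj₂ (refl , _)))) = j' , t' , refl , ℕ.≤-refl
⊑-cell {b = cell j' t'} (inj₂ (refl , _)) = j' , t' , refl , ℕ.≤-refl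
⊑-cell {b = point _ _} (inj₁ (inj₁ ()))
⊑-cell {b = point _ _} (inj₁ (inj₂ (() , _)))
⊑-cell {b = point _ _} (inj₂ (() , _))
⊑-cell {b = lowCell _} (inj₁ (inj₁ (s≤s ())))
⊑-cell {b = lowCell _} (inj₁ (inj₂ (() , _)))
⊑-cell {b = lowCell _} (inj₂ (() , _))
⊑-cell {b = topPoint _} (inj₁ (inj₁ (s≤s ())))
⊑-cell {b = topPoint _} (inj₁ (inj₂ (() , _)))
⊑-cell {b = topPoint _} (inj₂ (() , _))

⊑-lowCell-¬<ᵥ : ∀ {b t} → b ⊑ lowCell t → ¬ b <ᵥ lowCell t
⊑-lowCell-¬<ᵥ {b} b⊑ b< with <ᵥ-lowCell {b} b<
... | t' , refl , t<t' with ⊑-lowCell {b} b⊑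
...   | inj₁ (_ , refl , t'≤t) = ℕ.<⇒≱ t<t' t'≤t
...   | inj₂ pt = pt tt

cell-⊑-<ᵥ : ∀ {j t j' t'} → cell j t ⊑ cell j' t' → cell j t <ᵥ cell j' t' → j < j'
cell-⊑-<ᵥ _ (inj₁ (s≤s ()))
cell-⊑-<ᵥ _ (inj₂ (refl , inj₁ j<j')) = j<j'
cell-⊑-<ᵥ _ (inj₂ (refl , inj₂ (refl , inj₂ (refl , s≤s ()))))
cell-⊑-<ᵥ (inj₁ (inj₁ (s≤s (s≤s ())))) (inj₂ (refl , inj₂ (refl , inj₁ _)))
cell-⊑-<ᵥ (inj₁ (inj₂ (refl , inj₁ j<j))) (inj₂ (refl , inj₂ (refl , inj₁ _))) = j<j
cell-⊑-<ᵥ (inj₁ (inj₂ (refl , inj₂ (refl , t<t')))) (inj₂ (refl , inj₂ (refl , inj₁ t'<t))) =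
  ⊥-elim (ℕ.<-asym t<t' t'<t)
cell-⊑-<ᵥ (inj₂ (refl , _)) (inj₂ (refl , inj₂ (refl , inj₁ t<t))) = ⊥-elim (ℕ.<-irrefl refl t<t)

isPoint-of-312 : ∀ {a b c} → a ⊑ b → b ⊑ c → (c <ᵥ a ⊎ c ≡ a) → b <ᵥ c → IsPoint a
isPoint-of-312 {point _ _} _ _ _ _ = λ ()
isPoint-of-312 {topPoint _} _ _ _ _ = λ ()
isPoint-of-312 {lowCell t} _ b⊑c (inj₂ refl) b<c _ = ⊑-lowCell-¬<ᵥ b⊑c b<c
isPoint-of-312 {lowCell t} {c = c} _ b⊑c (inj₁ c<a) b<c _ with <ᵥ-lowCell {c} c<a
... | _ , refl , _ = ⊑-lowCell-¬<ᵥ b⊑c b<c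
isPoint-of-312 {cell j t} {b} {c} a⊑b b⊑c c≤a b<c _ with ⊑-cell {b = b} a⊑b
... | jb , tb , refl , j≤jb with ⊑-cell {b = c} b⊑c
...   | jc , tc , refl , jb≤jc = ℕ.<⇒≱ (ℕ.≤-<-trans j≤jb (cell-⊑-<ᵥ b⊑c b<c)) (jc≤j c≤a)
  where
  jc≤j : cell jc tc <ᵥ cell j t ⊎ cell jc tc ≡ cell j t → jc ≤ j
  jc≤j (inj₁ c<a) = cell-<ᵥ-cell c<a
  jc≤j (inj₂ refl) = ℕ.≤-refl

inversion⇒height< : ∀ {a a'} → IsPoint a → IsPoint a' → a ⊏ a' → a' <ᵥ a → height a < height a'
inversion⇒height< {lowCell _} pt _ _ _ = ⊥-elim (pt tt)
inversion⇒height< {cell _ _} pt _ _ _ = ⊥-elim (pt tt)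
inversion⇒height< {a' = lowCell _} _ pt _ _ = ⊥-elim (pt tt)
inversion⇒height< {a' = cell _ _} _ pt _ _ = ⊥-elim (pt tt)
inversion⇒height< {point j t} {point j' t'} _ _ (inj₁ ()) _
inversion⇒height< {point j t} {point j' t'} _ _ (inj₂ (refl , inj₂ (refl , t<t'))) _ = t<t'
inversion⇒height< {point j t} {point j' t'} _ _ (inj₂ (refl , inj₁ _)) (inj₁ (s≤s ()))
inversion⇒height< {point j t} {point j' t'} _ _ (inj₂ (refl , inj₁ j<j')) (inj₂ (refl , inj₁ j'<j)) =
  ⊥-elim (ℕ.<-asym j<j' j'<j)
inversion⇒height< {point j t} {point j' t'} _ _ (inj₂ (refl , inj₁ j<j)) (inj₂ (refl , inj₂ (refl , _))) =
  ⊥-elim (ℕ.<-irrefl refl j<j)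
inversion⇒height< {point j t} {topPoint t'} _ _ _ (inj₁ (s≤s ()))
inversion⇒height< {point j t} {topPoint t'} _ _ _ (inj₂ (() , _))
inversion⇒height< {topPoint t} {point j' t'} _ _ (inj₁ ()) _
inversion⇒height< {topPoint t} {point j' t'} _ _ (inj₂ (() , _)) _
inversion⇒height< {topPoint t} {topPoint t'} _ _ (inj₁ (s≤s ())) _
inversion⇒height< {topPoint t} {topPoint t'} _ _ (inj₂ (refl , inj₁ t<t')) _ = t<t'
inversion⇒height< {topPoint t} {topPoint t'} _ _ (inj₂ (refl , inj₂ (refl , s≤s ()))) _

ascent⇒column< : ∀ {K p a b} → 0 < K → Fits K p a → a ⊑ b → a <ᵥ b → column K a < column K b
ascent⇒column< {a = lowCell t} {lowCell t'} _ _ a⊑b a<b = ⊥-elim (⊑-lowCell-¬<ᵥ a⊑b a<b)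
ascent⇒column< {a = lowCell t} {point _ _} _ _ (inj₁ (inj₁ ())) _
ascent⇒column< {a = lowCell t} {point _ _} _ _ (inj₁ (inj₂ (() , _))) _
ascent⇒column< {a = lowCell t} {point _ _} _ _ (inj₂ (() , _)) _
ascent⇒column< {a = lowCell t} {cell _ _} _ _ _ _ = s≤s z≤n
ascent⇒column< {a = lowCell t} {topPoint _} 0<K _ _ _ = 0<K
ascent⇒column< {a = point j t} {lowCell _} _ _ _ (inj₁ ())
ascent⇒column< {a = point j t} {lowCell _} _ _ _ (inj₂ (() , _))
ascent⇒column< {a = point j t} {point j' t'} _ _ _ (inj₁ (s≤s ()))
ascent⇒column< {a = point j t} {point j' t'} _ _ _ (inj₂ (refl , inj₁ j<j')) = j<j'
ascent⇒column< {a = point j t} {point j' t'} _ _ (inj₁ (inj₁ ())) (inj₂ (refl , inj₂ (refl , _)))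
ascent⇒column< {a = point j t} {point j' t'} _ _ (inj₁ (inj₂ (refl , inj₁ j<j))) (inj₂ (refl , inj₂ (refl , _))) =
  ⊥-elim (ℕ.<-irrefl refl j<j)
ascent⇒column< {a = point j t} {point j' t'} _ _ (inj₁ (inj₂ (refl , inj₂ (refl , t<t'))))
               (inj₂ (refl , inj₂ (refl , inj₁ t'<t))) =
  ⊥-elim (ℕ.<-asym t<t' t'<t)
ascent⇒column< {a = point j t} {point j' t'} _ _ (inj₁ (inj₂ (refl , inj₂ (refl , _))))
               (inj₂ (refl , inj₂ (refl , inj₂ (refl , ()))))
ascent⇒column< {a = point j t} {point j' t'} _ _ (inj₂ (_ , ())) _
ascent⇒column< {a = point j t} {cell j' t'} _ _ _ (inj₁ (s≤s ()))
ascent⇒column< {a = point j t} {cell j' t'} _ _ _ (inj₂ (refl , inj₁ j<j')) = ℕ.m≤n⇒m≤1+n j<j'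
ascent⇒column< {a = point j t} {cell j' t'} _ _ _ (inj₂ (refl , inj₂ (refl , _))) = ℕ.≤-refl
ascent⇒column< {a = point j t} {topPoint _} _ (j<K , _) _ _ = j<K
ascent⇒column< {a = cell j t} {b} _ _ a⊑b a<b with ⊑-cell {b = b} a⊑b
... | j' , t' , refl , _ = s≤s (cell-⊑-<ᵥ a⊑b a<b)
ascent⇒column< {a = topPoint t} {b} _ _ a⊑b a<b with topPoint-<ᵥ {b = b} a<b
... | t' , refl , t'<t with a⊑b
...   | inj₁ (inj₁ (s≤s ()))
...   | inj₁ (inj₂ (refl , inj₁ t<t')) = ⊥-elim (ℕ.<-asym t<t' t'<t)
...   | inj₁ (inj₂ (refl , inj₂ (refl , s≤s ())))
...   | inj₂ (_ , ())

-- The skeleton of one side and its inflation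

row : (ℕ → ℕ → Letter) → ℕ → ℕ → ℕ → List Letter
row f j t zero = []
row f j t (suc c) = f j t ∷ row f j (suc t) c

grid : (ℕ → ℕ → Letter) → ℕ → ℕ → ℕ → List Letter
grid f T j zero = []
grid f T j (suc c) = row f j 0 T ++ grid f T (suc j) c

zigzag : ℕ → ℕ → List Letter
zigzag t zero = lowCell t ∷ []
zigzag t (suc c) = lowCell t ∷ topPoint t ∷ zigzag (suc t) c

skeleton : ℕ → ℕ → List Letter
skeleton K zero = []
skeleton K (suc p) = grid point p 0 K ++ zigzag 0 p ++ grid cell (suc p) 0 K

∈-row⁻ : ∀ f j t c {x} → x ∈ row f j t c → ∃[ t' ] x ≡ f j t' × t ≤ t' × t' < t + c
∈-row⁻ f j t (suc c) (here refl) = t , refl , ℕ.≤-refl , ℕ.m<m+n t (s≤s z≤n)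
∈-row⁻ f j t (suc c) (there x∈) with ∈-row⁻ f j (suc t) c x∈
... | t' , refl , t<t' , t'<t+c = t' , refl , ℕ.<⇒≤ t<t' , subst (t' <_) (sym (ℕ.+-suc t c)) t'<t+c

∈-grid⁻ : ∀ f T j c {x} → x ∈ grid f T j c → ∃[ j' ] ∃[ t' ] x ≡ f j' t' × j ≤ j' × j' < j + c × t' < T
∈-grid⁻ f T j (suc c) x∈ with ∈-++⁻ (row f j 0 T) x∈
... | inj₁ x∈row with ∈-row⁻ f j 0 T x∈row
...   | t' , refl , _ , t'<T = j , t' , refl , ℕ.≤-refl , ℕ.m<m+n j (s≤s z≤n) , t'<T
∈-grid⁻ f T j (suc c) x∈ | inj₂ x∈grid with ∈-grid⁻ f T (suc j) c x∈grid
...   | j' , t' , refl , j<j' , j'<j+c , t'<T =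
  j' , t' , refl , ℕ.<⇒≤ j<j' , subst (j' <_) (sym (ℕ.+-suc j c)) j'<j+c , t'<T

∈-row⁺ : ∀ f j t c {t'} → t ≤ t' → t' < t + c → f j t' ∈ row f j t c
∈-row⁺ f j t zero t≤t' t'<t+0 = ⊥-elim (ℕ.<⇒≱ t'<t+0 (subst (_≤ _) (sym (ℕ.+-identityʳ t)) t≤t'))
∈-row⁺ f j t (suc c) {t'} t≤t' t'<t+c with ℕ.m≤n⇒m<n∨m≡n t≤t'
... | inj₂ refl = here refl
... | inj₁ t<t' = there (∈-row⁺ f j (suc t) c t<t' (subst (t' <_) (ℕ.+-suc t c) t'<t+c))

∈-grid⁺ : ∀ f T j c {j' t'} → j ≤ j' → j' < j + c → t' < T → f j' t' ∈ grid f T j c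
∈-grid⁺ f T j zero j≤j' j'<j+0 _ = ⊥-elim (ℕ.<⇒≱ j'<j+0 (subst (_≤ _) (sym (ℕ.+-identityʳ j)) j≤j'))
∈-grid⁺ f T j (suc c) {j'} j≤j' j'<j+c t'<T with ℕ.m≤n⇒m<n∨m≡n j≤j'
... | inj₂ refl = ∈-++⁺ˡ (∈-row⁺ f j 0 T z≤n t'<T)
... | inj₁ j<j' = ∈-++⁺ʳ (row f j 0 T) (∈-grid⁺ f T (suc j) c j<j' (subst (j' <_) (ℕ.+-suc j c) j'<j+c) t'<T)

∈-zigzag⁻ : ∀ t c {x} → x ∈ zigzag t c →
  (∃[ t' ] x ≡ lowCell t' × t ≤ t' × t' ≤ t + c) ⊎ (∃[ t' ] x ≡ topPoint t' × t ≤ t' × t' < t + c)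
∈-zigzag⁻ t zero (here refl) = inj₁ (t , refl , ℕ.≤-refl , ℕ.m≤m+n t 0)
∈-zigzag⁻ t (suc c) (here refl) = inj₁ (t , refl , ℕ.≤-refl , ℕ.m≤m+n t (suc c))
∈-zigzag⁻ t (suc c) (there (here refl)) = inj₂ (t , refl , ℕ.≤-refl , ℕ.m<m+n t (s≤s z≤n))
∈-zigzag⁻ t (suc c) (there (there x∈)) with ∈-zigzag⁻ (suc t) c x∈
... | inj₁ (t' , refl , t<t' , t'≤) = inj₁ (t' , refl , ℕ.<⇒≤ t<t' , subst (t' ≤_) (sym (ℕ.+-suc t c)) t'≤)
... | inj₂ (t' , refl , t<t' , t'<) = inj₂ (t' , refl , ℕ.<⇒≤ t<t' , subst (t' <_) (sym (ℕ.+-suc t c)) t'<)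

lowCell∈zigzag : ∀ t c → lowCell t ∈ zigzag t c
lowCell∈zigzag t zero = here refl
lowCell∈zigzag t (suc c) = here refl

skeleton-fits : ∀ K p → All (Fits K p) (skeleton K p)
skeleton-fits K zero = []
skeleton-fits K (suc p) = All.tabulate fits
  where
  fits : ∀ {x} → x ∈ skeleton K (suc p) → Fits K (suc p) x
  fits x∈ with ∈-++⁻ (grid point p 0 K) x∈
  ... | inj₁ x∈points with ∈-grid⁻ point p 0 K x∈points
  ...   | _ , _ , refl , _ , j<K , t<p = j<K , s≤s t<p
  fits x∈ | inj₂ x∈rest with ∈-++⁻ (zigzag 0 p) x∈rest
  ...   | inj₁ x∈zigzag with ∈-zigzag⁻ 0 p x∈zigzag
  ...     | inj₁ (_ , refl , _ , t≤p) = s≤s t≤p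
  ...     | inj₂ (_ , refl , _ , t<p) = s≤s t<p
  fits x∈ | inj₂ x∈rest | inj₂ x∈cells with ∈-grid⁻ cell (suc p) 0 K x∈cells
  ...     | _ , _ , refl , _ , j<K , t<p = j<K , t<p

module _ {f : ℕ → ℕ → Letter} (row-⊏ : ∀ {j t t'} → t < t' → f j t ⊏ f j t')
         (col-⊏ : ∀ {j j' t t'} → j < j' → f j t ⊏ f j' t') where

  row-sorted : ∀ j t c → AllPairs _⊏_ (row f j t c)
  row-sorted j t zero = []
  row-sorted j t (suc c) = All.tabulate later ∷ row-sorted j (suc t) c
    where
    later : ∀ {y} → y ∈ row f j (suc t) c → f j t ⊏ y
    later y∈ with ∈-row⁻ f j (suc t) c y∈
    ... | _ , refl , t<t' , _ = row-⊏ t<t'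

  grid-sorted : ∀ T j c → AllPairs _⊏_ (grid f T j c)
  grid-sorted T j zero = []
  grid-sorted T j (suc c) = AllPairs.++⁺ (row-sorted j 0 T) (grid-sorted T (suc j) c)
    (All.tabulate λ x∈ → All.tabulate λ y∈ → across x∈ y∈)
    where
    across : ∀ {x y} → x ∈ row f j 0 T → y ∈ grid f T (suc j) c → x ⊏ y
    across x∈ y∈ with ∈-row⁻ f j 0 T x∈ | ∈-grid⁻ f T (suc j) c y∈
    ... | _ , refl , _ | _ , _ , refl , j<j' , _ = col-⊏ j<j'

zigzag-sorted : ∀ t c → AllPairs _⊏_ (zigzag t c)
zigzag-sorted t zero = [] ∷ []
zigzag-sorted t (suc c) = All.tabulate lowCell-first ∷ All.tabulate topPoint-first ∷ zigzag-sorted (suc t) c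
  where
  topPoint-first : ∀ {y} → y ∈ zigzag (suc t) c → topPoint t ⊏ y
  topPoint-first y∈ with ∈-zigzag⁻ (suc t) c y∈
  ... | inj₁ (_ , refl , t<t' , _) = inj₂ (refl , inj₁ t<t')
  ... | inj₂ (_ , refl , t<t' , _) = inj₂ (refl , inj₁ t<t')
  lowCell-first : ∀ {y} → y ∈ topPoint t ∷ zigzag (suc t) c → lowCell t ⊏ y
  lowCell-first (here refl) = inj₂ (refl , inj₂ (refl , s≤s z≤n))
  lowCell-first (there y∈) with ∈-zigzag⁻ (suc t) c y∈
  ... | inj₁ (_ , refl , t<t' , _) = inj₂ (refl , inj₁ t<t')
  ... | inj₂ (_ , refl , t<t' , _) = inj₂ (refl , inj₁ t<t')

skeleton-sorted : ∀ K p → AllPairs _⊏_ (skeleton K p)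
skeleton-sorted K zero = []
skeleton-sorted K (suc p) =
  AllPairs.++⁺ (grid-sorted {point} (λ t<t' → inj₂ (refl , inj₂ (refl , t<t'))) (λ j<j' → inj₂ (refl , inj₁ j<j')) p 0 K)
    (AllPairs.++⁺ (zigzag-sorted 0 p)
      (grid-sorted {cell} (λ t<t' → inj₂ (refl , inj₂ (refl , t<t'))) (λ j<j' → inj₂ (refl , inj₁ j<j')) (suc p) 0 K)
      (All.tabulate λ x∈ → All.tabulate λ y∈ → zigzag⊏cells x∈ y∈))
    (All.tabulate λ x∈ → All.tabulate λ y∈ → points⊏rest x∈ y∈)
  where
  zigzag⊏cells : ∀ {x y} → x ∈ zigzag 0 p → y ∈ grid cell (suc p) 0 K → x ⊏ y
  zigzag⊏cells x∈ y∈ with ∈-zigzag⁻ 0 p x∈ | ∈-grid⁻ cell (suc p) 0 K y∈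
  ... | inj₁ (_ , refl , _) | _ , _ , refl , _ = inj₁ (s≤s (s≤s z≤n))
  ... | inj₂ (_ , refl , _) | _ , _ , refl , _ = inj₁ (s≤s (s≤s z≤n))
  points⊏rest : ∀ {x y} → x ∈ grid point p 0 K → y ∈ zigzag 0 p ++ grid cell (suc p) 0 K → x ⊏ y
  points⊏rest x∈ y∈ with ∈-grid⁻ point p 0 K x∈ | ∈-++⁻ (zigzag 0 p) y∈
  ... | _ , _ , refl , _ | inj₂ y∈cells with ∈-grid⁻ cell (suc p) 0 K y∈cells
  ...   | _ , _ , refl , _ = inj₁ (s≤s z≤n)
  points⊏rest x∈ y∈ | _ , _ , refl , _ | inj₁ y∈zigzag with ∈-zigzag⁻ 0 p y∈zigzag
  ...   | inj₁ (_ , refl , _) = inj₁ (s≤s z≤n)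
  ...   | inj₂ (_ , refl , _) = inj₁ (s≤s z≤n)

cellCount pointCount : List Letter → ℕ
cellCount ls = length (filter isCell? ls)
pointCount ls = length (filter (¬? ∘ isCell?) ls)

cellCount-++ : ∀ xs ys → cellCount (xs ++ ys) ≡ cellCount xs + cellCount ys
cellCount-++ xs ys = trans (cong length (filter-++ isCell? xs ys)) (length-++ (filter isCell? xs))

cellCount-points : ∀ {ls} → All IsPoint ls → cellCount ls ≡ 0
cellCount-points pts = cong length (filter-none isCell? pts)

cellCount-grid-cell : ∀ T j c → cellCount (grid cell T j c) ≡ c * T
cellCount-grid-cell T j zero = refl
cellCount-grid-cell T j (suc c) =
  trans (cellCount-++ (row cell j 0 T) _) (cong₂ _+_ (row-count j 0 T) (cellCount-grid-cell T (suc j) c))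
  where
  row-count : ∀ j t c → cellCount (row cell j t c) ≡ c
  row-count j t zero = refl
  row-count j t (suc c) = cong suc (row-count j (suc t) c)

cellCount-zigzag : ∀ t c → cellCount (zigzag t c) ≡ suc c
cellCount-zigzag t zero = refl
cellCount-zigzag t (suc c) = cong suc (cellCount-zigzag (suc t) c)

cellCount-skeleton : ∀ K p → cellCount (skeleton K p) ≡ suc K * p
cellCount-skeleton K zero = sym (ℕ.*-zeroʳ (suc K))
cellCount-skeleton K (suc p) = begin
  cellCount (grid point p 0 K ++ zigzag 0 p ++ grid cell (suc p) 0 K)
    ≡⟨ cellCount-++ (grid point p 0 K) _ ⟩
  cellCount (grid point p 0 K) + cellCount (zigzag 0 p ++ grid cell (suc p) 0 K)
    ≡⟨ cong₂ _+_ (cellCount-points (All.tabulate points)) (cellCount-++ (zigzag 0 p) _) ⟩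
  cellCount (zigzag 0 p) + cellCount (grid cell (suc p) 0 K)
    ≡⟨ cong₂ _+_ (cellCount-zigzag 0 p) (cellCount-grid-cell (suc p) 0 K) ⟩
  suc p + K * suc p
    ∎
  where
  open ≡-Reasoning
  points : ∀ {x} → x ∈ grid point p 0 K → IsPoint x
  points x∈ with ∈-grid⁻ point p 0 K x∈
  ... | _ , _ , refl , _ = λ ()

-- A missing multiplicity counts as 0; `Multiplicities` below rules this case out.
inflate : List Letter → List ℕ → List Letter
inflate [] cs = []
inflate (a ∷ ls) cs with isCell? a | cs
... | no _  | cs = a ∷ inflate ls cs
... | yes _ | [] = inflate ls []
... | yes _ | c ∷ cs' = replicate c a ++ inflate ls cs'

length-inflate : ∀ ls cs → length cs ≡ cellCount ls → length (inflate ls cs) ≡ pointCount ls + sum cs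
length-inflate [] [] _ = refl
length-inflate (a ∷ ls) cs eq with isCell? a | cs
... | no _ | cs = cong suc (length-inflate ls cs eq)
... | yes _ | c ∷ cs' = begin
  length (replicate c a ++ inflate ls cs')          ≡⟨ length-++ (replicate c a) ⟩
  length (replicate c a) + length (inflate ls cs')  ≡⟨ cong₂ _+_ (length-replicate c)
                                                         (length-inflate ls cs' (ℕ.suc-injective eq)) ⟩
  c + (pointCount ls + sum cs')                     ≡⟨ +-CS.x∙yz≈y∙xz c (pointCount ls) (sum cs') ⟩
  pointCount ls + (c + sum cs')                     ∎
  where open ≡-Reasoning

∈-inflate⁻ : ∀ ls cs {x} → x ∈ inflate ls cs → x ∈ ls
∈-inflate⁻ (a ∷ ls) cs x∈ with isCell? a | cs
... | no _ | cs with x∈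
...   | here refl = here refl
...   | there x∈' = there (∈-inflate⁻ ls cs x∈')
∈-inflate⁻ (a ∷ ls) cs x∈ | yes _ | [] = there (∈-inflate⁻ ls [] x∈)
∈-inflate⁻ (a ∷ ls) cs x∈ | yes _ | c ∷ cs' with ∈-++⁻ (replicate c a) x∈
... | inj₁ x∈rep = here (∈-replicate⁻ x∈rep)
  where
  ∈-replicate⁻ : ∀ {x n} → x ∈ replicate n a → x ≡ a
  ∈-replicate⁻ {n = suc n} (here refl) = refl
  ∈-replicate⁻ {n = suc n} (there x∈) = ∈-replicate⁻ x∈
... | inj₂ x∈' = there (∈-inflate⁻ ls cs' x∈')

inflate-sorted : ∀ {ls} cs → AllPairs _⊏_ ls → AllPairs _⊑_ (inflate ls cs)
inflate-sorted cs [] = []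
inflate-sorted {a ∷ ls} cs (a⊏ls ∷ sorted) with isCell? a | cs
... | no _ | cs = All.tabulate (λ x∈ → inj₁ (All.lookup a⊏ls (∈-inflate⁻ ls cs x∈))) ∷ inflate-sorted cs sorted
... | yes _ | [] = inflate-sorted [] sorted
... | yes isc | c ∷ cs' = AllPairs.++⁺ (replicate-sorted c) (inflate-sorted cs' sorted)
  (All.replicate⁺ c (All.tabulate (λ x∈ → inj₁ (All.lookup a⊏ls (∈-inflate⁻ ls cs' x∈)))))
  where
  replicate-sorted : ∀ n → AllPairs _⊑_ (replicate n a)
  replicate-sorted zero = []
  replicate-sorted (suc n) = All.replicate⁺ n (inj₂ (refl , isc)) ∷ replicate-sorted n

Multiplicities : List Letter → List ℕ → Set
Multiplicities ls cs = length cs ≡ cellCount ls × All (1 ≤_) cs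

inflate-head : ∀ ℓ ls cs → Multiplicities (ℓ ∷ ls) cs → ∃[ F ] inflate (ℓ ∷ ls) cs ≡ ℓ ∷ F
inflate-head ℓ ls [] (len , _) with isCell? ℓ
... | no _ = inflate ls [] , refl
... | yes _ = ⊥-elim (ℕ.0≢1+n len)
inflate-head ℓ ls (zero ∷ cs) (_ , () ∷ _)
inflate-head ℓ ls (suc c ∷ cs) _ with isCell? ℓ
... | no _ = inflate ls (suc c ∷ cs) , refl
... | yes _ = replicate c ℓ ++ inflate ls cs , refl

-- The end of the run of each cell ℓ must be visible in the standardisation: the next letter is
-- larger than ℓ, or some letter seen before lies strictly between the next letter and ℓ. After the
-- last upper letter come the lower ones, which are below every letter seen.
following : List Letter → Maybe Letter → Maybe Letter
following [] next = next
following (x ∷ _) _ = just x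

RunEndMarked : (Letter → Set) → Letter → Maybe Letter → Set
RunEndMarked Seen ℓ nothing = ∃[ g ] Seen g × g <ᵥ ℓ
RunEndMarked Seen ℓ (just ℓ₂) = ℓ <ᵥ ℓ₂ ⊎ ∃[ g ] Seen g × ℓ₂ <ᵥ g × g <ᵥ ℓ

RunEndsMarked : (Letter → Set) → List Letter → Maybe Letter → Set
RunEndsMarked Seen [] next = ⊤
RunEndsMarked Seen (ℓ ∷ ls) next =
  (IsCell ℓ → RunEndMarked Seen ℓ (following ls next)) × RunEndsMarked (λ g → g ≡ ℓ ⊎ Seen g) ls next

RunEndMarked-mono : ∀ {Seen Seen' : Letter → Set} ℓ next → (∀ {g} → Seen g → Seen' g) →
  RunEndMarked Seen ℓ next → RunEndMarked Seen' ℓ next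
RunEndMarked-mono ℓ nothing f (g , seen , g<ℓ) = g , f seen , g<ℓ
RunEndMarked-mono ℓ (just _) f (inj₁ ℓ<ℓ₂) = inj₁ ℓ<ℓ₂
RunEndMarked-mono ℓ (just _) f (inj₂ (g , seen , between)) = inj₂ (g , f seen , between)

RunEndsMarked-mono : ∀ {Seen Seen' : Letter → Set} ls next → (∀ {g} → Seen g → Seen' g) →
  RunEndsMarked Seen ls next → RunEndsMarked Seen' ls next
RunEndsMarked-mono [] next f _ = tt
RunEndsMarked-mono (ℓ ∷ ls) next f (marked , rest) =
  (λ isc → RunEndMarked-mono ℓ _ f (marked isc)) ,
  RunEndsMarked-mono ls next (λ { (inj₁ e) → inj₁ e ; (inj₂ seen) → inj₂ (f seen) }) rest

RunEndsMarked-++ : ∀ Seen xs ys next → RunEndsMarked Seen xs (following ys next) →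
  RunEndsMarked (λ g → g ∈ xs ⊎ Seen g) ys next → RunEndsMarked Seen (xs ++ ys) next
RunEndsMarked-++ Seen [] ys next _ marked = RunEndsMarked-mono ys next (λ { (inj₂ seen) → seen }) marked
RunEndsMarked-++ Seen (x ∷ xs) ys next (marked , rest) marked-ys =
  (λ isc → subst (RunEndMarked Seen x) (following-++ xs) (marked isc)) ,
  RunEndsMarked-++ _ xs ys next rest (RunEndsMarked-mono ys next regroup marked-ys)
  where
  following-++ : ∀ xs → following xs (following ys next) ≡ following (xs ++ ys) next
  following-++ [] = refl
  following-++ (_ ∷ _) = refl
  regroup : ∀ {g} → g ∈ x ∷ xs ⊎ Seen g → g ∈ xs ⊎ (g ≡ x ⊎ Seen g)
  regroup (inj₁ (here e)) = inj₂ (inj₁ e)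
  regroup (inj₁ (there g∈)) = inj₁ g∈
  regroup (inj₂ seen) = inj₂ (inj₂ seen)

RunEndsMarked-points : ∀ Seen xs next → All IsPoint xs → RunEndsMarked Seen xs next
RunEndsMarked-points Seen [] next [] = tt
RunEndsMarked-points Seen (x ∷ xs) next (pt ∷ pts) = (λ isc → ⊥-elim (pt isc)) , RunEndsMarked-points _ xs next pts

zigzag-runEndsMarked : ∀ Seen t c ℓ₂ → (∀ t' → lowCell t' <ᵥ ℓ₂) → RunEndsMarked Seen (zigzag t c) (just ℓ₂)
zigzag-runEndsMarked Seen t zero ℓ₂ below = (λ _ → inj₁ (below t)) , tt
zigzag-runEndsMarked Seen t (suc c) ℓ₂ below =
  (λ _ → inj₁ (inj₁ (s≤s z≤n))) , (λ ()) ,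
  RunEndsMarked-mono (zigzag (suc t) c) (just ℓ₂) (inj₂ ∘ inj₂) (zigzag-runEndsMarked Seen (suc t) c ℓ₂ below)

cellRow-runEndsMarked : ∀ Seen j t c next → (∀ t' → t ≤ t' → t' < t + c → Seen (point j t')) →
  RunEndMarked Seen (cell j (t + c)) next → RunEndsMarked Seen (row cell j t (suc c)) next
cellRow-runEndsMarked Seen j t zero next _ last =
  (λ _ → subst (λ t' → RunEndMarked Seen (cell j t') next) (ℕ.+-identityʳ t) last) , tt
cellRow-runEndsMarked Seen j t (suc c) next seen last =
  (λ _ → inj₂ (point j t , seen t ℕ.≤-refl (ℕ.m<m+n t (s≤s z≤n)) ,
                inj₂ (refl , inj₂ (refl , inj₁ ℕ.≤-refl)) , inj₂ (refl , inj₂ (refl , inj₂ (refl , s≤s z≤n))))) ,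
  RunEndsMarked-mono (row cell j (suc t) (suc c)) next inj₂
    (cellRow-runEndsMarked Seen j (suc t) c next
      (λ t' t<t' t'< → seen t' (ℕ.<⇒≤ t<t') (subst (t' <_) (sym (ℕ.+-suc t c)) t'<))
      (subst (λ t' → RunEndMarked Seen (cell j t') next) (ℕ.+-suc t c) last))

cellGrid-runEndsMarked : ∀ Seen p j c → (∀ j' t' → j ≤ j' → j' < j + c → t' < p → Seen (point j' t')) →
  Seen (lowCell 0) → RunEndsMarked Seen (grid cell (suc p) j c) nothing
cellGrid-runEndsMarked Seen p j zero _ _ = tt
cellGrid-runEndsMarked Seen p j (suc c) seen seen₀ =
  RunEndsMarked-++ Seen (row cell j 0 (suc p)) (grid cell (suc p) (suc j) c) nothing
    (cellRow-runEndsMarked Seen j 0 p _ (λ t' _ t'<p → seen j t' ℕ.≤-refl (ℕ.m<m+n j (s≤s z≤n)) t'<p) (rowEnd c))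
    (RunEndsMarked-mono (grid cell (suc p) (suc j) c) nothing inj₂
      (cellGrid-runEndsMarked Seen p (suc j) c
        (λ j' t' j<j' j'< t'<p → seen j' t' (ℕ.<⇒≤ j<j') (subst (j' <_) (sym (ℕ.+-suc j c)) j'<) t'<p) seen₀))
  where
  rowEnd : ∀ c → RunEndMarked Seen (cell j (0 + p)) (following (grid cell (suc p) (suc j) c) nothing)
  rowEnd zero = lowCell 0 , seen₀ , inj₁ (s≤s z≤n)
  rowEnd (suc c) = inj₁ (inj₂ (refl , inj₁ ℕ.≤-refl))

skeleton-runEndsMarked : ∀ Seen K p → 0 < K → RunEndsMarked Seen (skeleton K p) nothing
skeleton-runEndsMarked Seen K zero _ = tt
skeleton-runEndsMarked Seen (suc K) (suc p) _ =
  RunEndsMarked-++ Seen (grid point p 0 (suc K)) _ nothing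
    (RunEndsMarked-points Seen _ _ (All.tabulate points))
    (RunEndsMarked-++ Seen₁ (zigzag 0 p) _ nothing (zigzag-runEndsMarked Seen₁ 0 p (cell 0 0) (λ _ → inj₁ (s≤s z≤n)))
      (cellGrid-runEndsMarked Seen₂ p 0 (suc K)
        (λ j' t' _ j'<K t'<p → inj₂ (inj₁ (∈-grid⁺ point p 0 (suc K) z≤n j'<K t'<p)))
        (inj₁ (lowCell∈zigzag 0 p))))
  where
  Seen₁ Seen₂ : Letter → Set
  Seen₁ g = g ∈ grid point p 0 (suc K) ⊎ Seen g
  Seen₂ g = g ∈ zigzag 0 p ⊎ Seen₁ g
  points : ∀ {x} → x ∈ grid point p 0 (suc K) → IsPoint x
  points x∈ with ∈-grid⁻ point p 0 (suc K) x∈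
  ... | _ , _ , refl , _ = λ ()

-- Words and their standardisation

Signed : Set
Signed = Letter ⊎ Letter

pattern lower a = inj₁ a
pattern upper a = inj₂ a

infix 4 _<ₛ_ _⊑ₛ_

_<ₛ_ : Signed → Signed → Set
_<ₛ_ = flip _<ᵥ_ ⊎-< _<ᵥ_

<ₛ-isStrictTotalOrder : IsStrictTotalOrder _≡_ _<ₛ_
<ₛ-isStrictTotalOrder = isStrictTotalOrder-≡ Pointwise-≡⇒≡
  (⊎-<-isStrictTotalOrder (Flip.isStrictTotalOrder <ᵥ-isStrictTotalOrder) <ᵥ-isStrictTotalOrder)

_⊑ₛ_ : Signed → Signed → Set
upper a ⊑ₛ upper b = a ⊑ b
upper _ ⊑ₛ lower _ = ⊤
lower _ ⊑ₛ upper _ = ⊥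
lower a ⊑ₛ lower b = b ⊑ a

Fitsₛ : ℕ → ℕ → ℕ → Signed → Set
Fitsₛ K p q (upper a) = Fits K p a
Fitsₛ K p q (lower a) = Fits K q a

infixl 10 _!_

-- Only positions inside the word are ever looked up; the default is junk.
_!_ : List Signed → ℕ → Signed
W ! i = lookupOr (upper (lowCell 0)) W i

-- Equal letters are ordered by decreasing position, so that every run becomes decreasing.
Below : List Signed → ℕ → ℕ → Set
Below W = ×-Lex _≡_ _<ₛ_ _>_ on (λ u → W ! u , u)

Below-isStrictTotalOrder : ∀ W → IsStrictTotalOrder _≡_ (Below W)
Below-isStrictTotalOrder W = on-isStrictTotalOrder (λ u → W ! u , u) (cong proj₂)
  (×-Lex-isStrictTotalOrder <ₛ-isStrictTotalOrder >-isStrictTotalOrder)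

module Standardise (W : List Signed) (n : ℕ) =
  Standardisation {n} (Below W on toℕ) (on-isStrictTotalOrder toℕ Fin.toℕ-injective (Below-isStrictTotalOrder W))

word : ℕ → ℕ → ℕ → List ℕ → List ℕ → List Signed
word K p q cx cy = map upper (inflate (skeleton K p) cx) ++ map lower (reverse (inflate (skeleton K q) cy))

module _ (K p q : ℕ) (cx cy : List ℕ) where

  word-sorted : AllPairs _⊑ₛ_ (word K p q cx cy)
  word-sorted = AllPairs.++⁺ (AllPairs.map⁺ (inflate-sorted cx (skeleton-sorted K p)))
    (AllPairs.map⁺ (AllPairs-reverse (inflate-sorted cy (skeleton-sorted K q))))
    (All.map⁺ (All.universal (λ _ → All.map⁺ (All.universal (λ _ → tt) _)) _))

  word-fits : All (Fitsₛ K p q) (word K p q cx cy)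
  word-fits = All.++⁺ (All.map⁺ (fits (skeleton K p) cx (skeleton-fits K p)))
    (All.map⁺ (All.tabulate λ x∈ → All.lookup (fits (skeleton K q) cy (skeleton-fits K q)) (Any.reverse⁻ x∈)))
    where
    fits : ∀ {r} ls cs → All (Fits K r) ls → All (Fits K r) (inflate ls cs)
    fits ls cs fits-ls = All.tabulate λ x∈ → All.lookup fits-ls (∈-inflate⁻ ls cs x∈)

  length-word : length (word K p q cx cy) ≡ length (inflate (skeleton K p) cx) + length (inflate (skeleton K q) cy)
  length-word = trans (length-++ (map upper (inflate (skeleton K p) cx)))
    (cong₂ _+_ (length-map upper (inflate (skeleton K p) cx))
      (trans (length-map lower (reverse (inflate (skeleton K q) cy))) (length-reverse (inflate (skeleton K q) cy))))

-- Avoidance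

IsUpper IsLower : Signed → Set
IsUpper (upper _) = ⊤
IsUpper (lower _) = ⊥
IsLower (upper _) = ⊥
IsLower (lower _) = ⊤

columnₛ : ℕ → Signed → ℕ
columnₛ K (upper a) = column K a
columnₛ K (lower a) = K ∸ column K a

columnₛ≤ : ∀ {K p q} a → Fitsₛ K p q a → columnₛ K a ≤ K
columnₛ≤ (upper a) fits = column≤ a fits
columnₛ≤ {K} (lower a) _ = ℕ.m∸n≤m K (column K a)

ascentₛ⇒column< : ∀ {K p q} a b → 0 < K → Fitsₛ K p q a → Fitsₛ K p q b → a ⊑ₛ b → a <ₛ b →
  columnₛ K a < columnₛ K b
ascentₛ⇒column< (upper a) (upper b) 0<K fits-a _ a⊑b (₂∼₂ a<b) = ascent⇒column< {a = a} {b} 0<K fits-a a⊑b a<b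
ascentₛ⇒column< (lower a) (lower b) 0<K fits-a fits-b b⊑a (₁∼₁ b<a) =
  ℕ.∸-monoʳ-< (ascent⇒column< {a = b} {a} 0<K fits-b b⊑a b<a) (column≤ a fits-a)

upper-⊑ₛ : ∀ a b → a ⊑ₛ b → IsUpper b → IsUpper a
upper-⊑ₛ (upper _) (upper _) _ _ = tt

lower-⊑ₛ : ∀ a b → a ⊑ₛ b → IsLower a → IsLower b
lower-⊑ₛ (lower _) (lower _) _ _ = tt

isPoint-of-312ᵘ : ∀ a b c → a ⊑ₛ b → b ⊑ₛ c → (c <ₛ a ⊎ c ≡ a) → b <ₛ c → IsUpper b → IsPoint (reduce a)
isPoint-of-312ᵘ (upper a) (upper b) (upper c) a⊑b b⊑c (inj₁ (₂∼₂ c<a)) (₂∼₂ b<c) _ =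
  isPoint-of-312 {a} {b} {c} a⊑b b⊑c (inj₁ c<a) b<c
isPoint-of-312ᵘ (upper a) (upper b) (upper c) a⊑b b⊑c (inj₂ refl) (₂∼₂ b<c) _ =
  isPoint-of-312 {a} {b} {c} a⊑b b⊑c (inj₂ refl) b<c

isPoint-of-312ˡ : ∀ a b c → a ⊑ₛ b → b ⊑ₛ c → (c <ₛ a ⊎ c ≡ a) → a <ₛ b → IsLower a → IsPoint (reduce c)
isPoint-of-312ˡ (lower a) (lower b) (lower c) b⊑a c⊑b (inj₁ (₁∼₁ a<c)) (₁∼₁ b<a) _ =
  isPoint-of-312 {c} {b} {a} c⊑b b⊑a (inj₁ a<c) b<a
isPoint-of-312ˡ (lower a) (lower b) (lower c) b⊑a c⊑b (inj₂ refl) (₁∼₁ b<a) _ =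
  isPoint-of-312 {c} {b} {a} c⊑b b⊑a (inj₂ refl) b<a

inversionᵘ⇒height< : ∀ a b → IsPoint (reduce a) → IsPoint (reduce b) → a ⊑ₛ b → b <ₛ a → IsUpper b →
  height (reduce a) < height (reduce b)
inversionᵘ⇒height< (upper a) (upper b) pt-a pt-b (inj₁ a⊏b) (₂∼₂ b<a) _ = inversion⇒height< {a} {b} pt-a pt-b a⊏b b<a
inversionᵘ⇒height< (upper a) (upper b) pt-a _ (inj₂ (_ , isc)) _ _ = ⊥-elim (pt-a isc)

inversionˡ⇒height< : ∀ a b → IsPoint (reduce a) → IsPoint (reduce b) → a ⊑ₛ b → b <ₛ a → IsLower a →
  height (reduce b) < height (reduce a)
inversionˡ⇒height< (lower a) (lower b) pt-a pt-b (inj₁ b⊏a) (₁∼₁ a<b) _ = inversion⇒height< {b} {a} pt-b pt-a b⊏a a<b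
inversionˡ⇒height< (lower a) (lower b) _ pt-b (inj₂ (_ , isc)) _ _ = ⊥-elim (pt-b isc)

upper-fits : ∀ {K p q} a → IsUpper a → Fitsₛ K p q a → Fits K p (reduce a)
upper-fits (upper a) _ fits = fits

lower-fits : ∀ {K p q} a → IsLower a → Fitsₛ K p q a → Fits K q (reduce a)
lower-fits (lower a) _ fits = fits

side : ∀ a → IsUpper a ⊎ IsLower a
side (upper _) = inj₁ tt
side (lower _) = inj₂ tt

Below-forward : ∀ {W u x} → u < x → Below W u x → W ! u <ₛ W ! x
Below-forward _ (inj₁ Wu<Wx) = Wu<Wx
Below-forward u<x (inj₂ (_ , x<u)) = ⊥-elim (ℕ.<-asym u<x x<u)

Below-backward : ∀ {W u x} → u < x → Below W x u → W ! x <ₛ W ! u ⊎ W ! x ≡ W ! u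
Below-backward _ (inj₁ Wx<Wu) = inj₁ Wx<Wu
Below-backward _ (inj₂ (Wx≡Wu , _)) = inj₂ Wx≡Wu

⊑ₛ-point-irrefl : ∀ a → IsPoint (reduce a) → ¬ a ⊑ₛ a
⊑ₛ-point-irrefl (upper a) pt = ⊑-point-irrefl {a} pt
⊑ₛ-point-irrefl (lower a) pt = ⊑-point-irrefl {a} pt

β-middle : ∀ p q (i : Fin (p + q + 2)) → toℕ i ≡ p → β p q i ≡ suc q
β-middle p q i i≡p with toℕ i ℕ.≟ p
... | yes _ = refl
... | no i≢p = ⊥-elim (i≢p i≡p)

β-middle₊₁ : ∀ p q (i : Fin (p + q + 2)) → toℕ i ≡ suc p → β p q i ≡ suc (suc q)
β-middle₊₁ p q i i≡p+1 with toℕ i ℕ.≟ p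
... | yes i≡p = ⊥-elim (ℕ.<-irrefl (trans (sym i≡p) i≡p+1) (ℕ.n<1+n p))
... | no _ with toℕ i ℕ.≟ suc p
...   | yes _ = refl
...   | no i≢p+1 = ⊥-elim (i≢p+1 i≡p+1)

β-outer : ∀ p q (i : Fin (p + q + 2)) → toℕ i ≢ p → toℕ i ≢ suc p → β p q i ≡ p + q + 2 ∸ toℕ i
β-outer p q i i≢p i≢p+1 with toℕ i ℕ.≟ p
... | yes i≡p = ⊥-elim (i≢p i≡p)
... | no _ with toℕ i ℕ.≟ suc p
...   | yes i≡p+1 = ⊥-elim (i≢p+1 i≡p+1)
...   | no _ = refl

p+q+2≡p+[2+q] : ∀ p q → p + q + 2 ≡ p + suc (suc q)
p+q+2≡p+[2+q] p q = trans (ℕ.+-assoc p q 2) (cong (_+_ p) (ℕ.+-comm q 2))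

2+q<p+q+2∸i : ∀ p q {i} → i < p → suc (suc q) < p + q + 2 ∸ i
2+q<p+q+2∸i p q {i} i<p = ℕ.m+n≤o⇒m≤o∸n (3 + q) (begin
  3 + q + i       ≡⟨ ℕ.+-comm (3 + q) i ⟩
  i + (3 + q)     ≡⟨ ℕ.+-suc i (2 + q) ⟩
  suc i + (2 + q) ≤⟨ ℕ.+-monoˡ-≤ (2 + q) i<p ⟩
  p + (2 + q)     ≡⟨ sym (p+q+2≡p+[2+q] p q) ⟩
  p + q + 2       ∎)
  where open ℕ.≤-Reasoning

p+q+2∸i<1+q : ∀ p q {i} → p + 2 ≤ i → p + q + 2 ∸ i < suc q
p+q+2∸i<1+q p q {i} p+2≤i = s≤s (begin
  p + q + 2 ∸ i         ≤⟨ ℕ.∸-monoʳ-≤ (p + q + 2) p+2≤i ⟩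
  p + q + 2 ∸ (p + 2)   ≡⟨ cong (_∸ (p + 2)) (p+q+2≡p+[2+q] p q) ⟩
  p + (2 + q) ∸ (p + 2) ≡⟨ ℕ.[m+n]∸[m+o]≡n∸o p (2 + q) 2 ⟩
  2 + q ∸ 2             ≡⟨⟩
  q                     ∎)
  where open ℕ.≤-Reasoning

module Avoidance {K p q n : ℕ} (0<K : 0 < K) (W : List Signed)
  (sorted : ∀ {i j} → i < j → j < n → W ! i ⊑ₛ W ! j)
  (fits : ∀ {i} → i < n → Fitsₛ K p q (W ! i))
  (π : Vec (Fin n) n)
  (π⇒Below : ∀ {i j} → toℕ (lookup π i) < toℕ (lookup π j) → Below W (toℕ i) (toℕ j)) where

  module Occurrence {k} {τ : Fin k → ℕ} (e : Fin k → Fin n)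
    (increasing : ∀ i j → i Fin.< j → e i Fin.< e j)
    (order : ∀ i j → (τ i < τ j) ⇔ (lookup π (e i) Fin.< lookup π (e j))) where

    pos : ∀ i → i < k → ℕ
    pos i i< = toℕ (e (fromℕ< i<))

    letter : ∀ i → i < k → Signed
    letter i i< = W ! pos i i<

    pos-< : ∀ {i j} (i< : i < k) (j< : j < k) → i < j → pos i i< < pos j j<
    pos-< i< j< i<j = increasing _ _ (subst₂ _<_ (sym (Fin.toℕ-fromℕ< i<)) (sym (Fin.toℕ-fromℕ< j<)) i<j)

    letter-⊑ₛ : ∀ {i j} (i< : i < k) (j< : j < k) → i < j → letter i i< ⊑ₛ letter j j<
    letter-⊑ₛ i< j< i<j = sorted (pos-< i< j< i<j) (Fin.toℕ<n _)

    letter-fits : ∀ {i} (i< : i < k) → Fitsₛ K p q (letter i i<)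
    letter-fits i< = fits (Fin.toℕ<n _)

    below : ∀ {i j} (i< : i < k) (j< : j < k) → τ (fromℕ< i<) < τ (fromℕ< j<) → Below W (pos i i<) (pos j j<)
    below i< j< τi<τj = π⇒Below (Equivalence.to (order _ _) τi<τj)

    ascent : ∀ {i j} (i< : i < k) (j< : j < k) → i < j → τ (fromℕ< i<) < τ (fromℕ< j<) → letter i i< <ₛ letter j j<
    ascent i< j< i<j τi<τj = Below-forward {W} (pos-< i< j< i<j) (below i< j< τi<τj)

    descent : ∀ {i j} (i< : i < k) (j< : j < k) → i < j → τ (fromℕ< j<) < τ (fromℕ< i<) →
      letter j j< <ₛ letter i i< ⊎ letter j j< ≡ letter i i<
    descent i< j< i<j τj<τi = Below-backward {W} (pos-< i< j< i<j) (below j< i< τj<τi)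

    descent-point : ∀ {i j} (i< : i < k) (j< : j < k) → i < j → τ (fromℕ< j<) < τ (fromℕ< i<) →
      IsPoint (reduce (letter i i<)) → letter j j< <ₛ letter i i<
    descent-point {i} {j} i< j< i<j τj<τi pt with descent i< j< i<j τj<τi
    ... | inj₁ lt = lt
    ... | inj₂ eq = ⊥-elim (⊑ₛ-point-irrefl _ pt (subst (letter i i< ⊑ₛ_) eq (letter-⊑ₛ i< j< i<j)))

  α-avoided : Avoids π (α (suc (suc K)))
  α-avoided (e , increasing , order) =
    ℕ.<⇒≱ (s≤s (columnₛ≤ (letter (suc K) last<) (letter-fits last<))) (ascending⇒≥index columns step (suc K) last<)
    where
    open Occurrence e increasing order
    last< : suc K < suc (suc K)
    last< = ℕ.≤-refl
    columns : ∀ i → i < suc (suc K) → ℕ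
    columns i i< = columnₛ K (letter i i<)
    step : ∀ i (i< : i < suc (suc K)) (si< : suc i < suc (suc K)) → columns i i< < columns (suc i) si<
    step i i< si< = ascentₛ⇒column< _ _ 0<K (letter-fits i<) (letter-fits si<) (letter-⊑ₛ i< si< (ℕ.n<1+n i))
      (ascent i< si< (ℕ.n<1+n i) (s≤s (subst₂ _<_ (sym (Fin.toℕ-fromℕ< i<)) (sym (Fin.toℕ-fromℕ< si<)) (ℕ.n<1+n i))))

  module βOccurrence (e : Fin (p + q + 2) → Fin n)
    (increasing : ∀ i j → i Fin.< j → e i Fin.< e j)
    (order : ∀ i j → (β p q i < β p q j) ⇔ (lookup π (e i) Fin.< lookup π (e j))) where
    open Occurrence e increasing order public
    s : ℕ
    s = p + q + 2
    x< : p < s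
    x< = subst (p <_) (sym (p+q+2≡p+[2+q] p q)) (ℕ.m<m+n p (s≤s z≤n))
    y< : suc p < s
    y< = subst₂ _<_ (ℕ.+-comm p 1) (sym (p+q+2≡p+[2+q] p q)) (ℕ.+-monoʳ-< p {1} {2 + q} (s≤s (s≤s z≤n)))
    β-x : β p q (fromℕ< x<) ≡ suc q
    β-x = β-middle p q _ (Fin.toℕ-fromℕ< x<)
    β-y : β p q (fromℕ< y<) ≡ suc (suc q)
    β-y = β-middle₊₁ p q _ (Fin.toℕ-fromℕ< y<)
    β-outer′ : ∀ {i} (i< : i < s) → i ≢ p → i ≢ suc p → β p q (fromℕ< i<) ≡ s ∸ i
    β-outer′ i< i≢p i≢p+1 = trans
      (β-outer p q _ (λ e → i≢p (trans (sym (Fin.toℕ-fromℕ< i<)) e)) (λ e → i≢p+1 (trans (sym (Fin.toℕ-fromℕ< i<)) e)))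
      (cong (s ∸_) (Fin.toℕ-fromℕ< i<))
    x-below-y : letter p x< <ₛ letter (suc p) y<
    x-below-y = ascent x< y< (ℕ.n<1+n p) (subst₂ _<_ (sym β-x) (sym β-y) (ℕ.n<1+n (suc q)))

    upper-impossible : IsUpper (letter p x<) → ⊥
    upper-impossible upper-x with predecessor (Fits⇒0<p _ (upper-fits _ upper-x (letter-fits x<)))
    ... | p' , p'+1≡p = ℕ.<⇒≱ (ℕ.≤-pred (subst (suc (suc (heights p' last<)) ≤_) (sym p'+1≡p) (bound p' last<)))
                               (ascending⇒≥index heights step p' last<)
      where
      last< : p' < p
      last< = subst (p' <_) p'+1≡p ℕ.≤-refl
      λ< : ∀ {i} → i < p → i < s
      λ< i<p = ℕ.<-trans i<p x<
      λ≢p : ∀ {i} → i < p → i ≢ p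
      λ≢p i<p refl = ℕ.<-irrefl refl i<p
      λ≢p+1 : ∀ {i} → i < p → i ≢ suc p
      λ≢p+1 i<p refl = ℕ.<-asym i<p (ℕ.n<1+n _)
      λ-upper : ∀ {i} (i<p : i < p) → IsUpper (letter i (λ< i<p))
      λ-upper i<p = upper-⊑ₛ _ _ (letter-⊑ₛ (λ< i<p) x< i<p) upper-x
      λ-point : ∀ {i} (i<p : i < p) → IsPoint (reduce (letter i (λ< i<p)))
      λ-point {i} i<p = isPoint-of-312ᵘ _ _ _ (letter-⊑ₛ (λ< i<p) x< i<p) (letter-⊑ₛ x< y< (ℕ.n<1+n p))
        (descent (λ< i<p) y< (ℕ.<-trans i<p (ℕ.n<1+n p))
          (subst₂ _<_ (sym β-y) (sym (β-outer′ (λ< i<p) (λ≢p i<p) (λ≢p+1 i<p))) (2+q<p+q+2∸i p q i<p)))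
        x-below-y upper-x
      heights : ∀ i → i < p → ℕ
      heights i i<p = height (reduce (letter i (λ< i<p)))
      step : ∀ i (i<p : i < p) (si<p : suc i < p) → heights i i<p < heights (suc i) si<p
      step i i<p si<p = inversionᵘ⇒height< _ _ (λ-point i<p) (λ-point si<p) (letter-⊑ₛ (λ< i<p) (λ< si<p) (ℕ.n<1+n i))
        (descent-point (λ< i<p) (λ< si<p) (ℕ.n<1+n i)
          (subst₂ _<_ (sym (β-outer′ (λ< si<p) (λ≢p si<p) (λ≢p+1 si<p))) (sym (β-outer′ (λ< i<p) (λ≢p i<p) (λ≢p+1 i<p)))
            (ℕ.∸-monoʳ-< (ℕ.n<1+n i) (ℕ.<⇒≤ (λ< si<p))))
          (λ-point i<p))
        (λ-upper si<p)
      bound : ∀ i (i<p : i < p) → suc (heights i i<p) < p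
      bound i i<p = suc-height< _ (λ-point i<p) (upper-fits _ (λ-upper i<p) (letter-fits (λ< i<p)))

    lower-impossible : IsLower (letter p x<) → ⊥
    lower-impossible lower-x with predecessor (Fits⇒0<p _ (lower-fits _ lower-x (letter-fits x<)))
    ... | q' , q'+1≡q = ℕ.<⇒≱ (ℕ.≤-pred (subst (suc (suc (heights 0 first<)) ≤_) (sym q'+1≡q) (bound 0 first<)))
                               (descending⇒≥distance heights step q' 0 first< q'+1≡q)
      where
      first< : 0 < q
      first< = subst (0 <_) q'+1≡q (s≤s z≤n)
      μ : ℕ → ℕ
      μ j = p + 2 + j
      μ< : ∀ {j} → j < q → μ j < s
      μ< {j} j<q = subst₂ _<_ (sym (ℕ.+-assoc p 2 j)) (sym (p+q+2≡p+[2+q] p q)) (ℕ.+-monoʳ-< p (s≤s (s≤s j<q)))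
      p+2≤μ : ∀ j → p + 2 ≤ μ j
      p+2≤μ j = ℕ.m≤m+n (p + 2) j
      x<μ : ∀ j → p < μ j
      x<μ j = ℕ.<-≤-trans (subst (p <_) (ℕ.+-comm 2 p) (ℕ.m<n+m p {2} (s≤s z≤n))) (p+2≤μ j)
      y<μ : ∀ j → suc p < μ j
      y<μ j = ℕ.<-≤-trans (subst (suc p <_) (ℕ.+-comm 2 p) (ℕ.n<1+n (suc p))) (p+2≤μ j)
      β-μ : ∀ {j} (j<q : j < q) → β p q (fromℕ< (μ< j<q)) ≡ s ∸ μ j
      β-μ {j} j<q = β-outer′ (μ< j<q) (λ e → ℕ.<-irrefl (sym e) (x<μ j)) (λ e → ℕ.<-irrefl (sym e) (y<μ j))
      μ-lower : ∀ {j} (j<q : j < q) → IsLower (letter (μ j) (μ< j<q))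
      μ-lower {j} j<q = lower-⊑ₛ _ _ (letter-⊑ₛ x< (μ< j<q) (x<μ j)) lower-x
      μ-point : ∀ {j} (j<q : j < q) → IsPoint (reduce (letter (μ j) (μ< j<q)))
      μ-point {j} j<q = isPoint-of-312ˡ _ _ _ (letter-⊑ₛ x< y< (ℕ.n<1+n p)) (letter-⊑ₛ y< (μ< j<q) (y<μ j))
        (descent x< (μ< j<q) (x<μ j) (subst₂ _<_ (sym (β-μ j<q)) (sym β-x) (p+q+2∸i<1+q p q (p+2≤μ j))))
        x-below-y lower-x
      heights : ∀ j → j < q → ℕ
      heights j j<q = height (reduce (letter (μ j) (μ< j<q)))
      step : ∀ j (j<q : j < q) (sj<q : suc j < q) → heights (suc j) sj<q < heights j j<q
      step j j<q sj<q = inversionˡ⇒height< _ _ (μ-point j<q) (μ-point sj<q) (letter-⊑ₛ (μ< j<q) (μ< sj<q) μj<μsj)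
        (descent-point (μ< j<q) (μ< sj<q) μj<μsj
          (subst₂ _<_ (sym (β-μ sj<q)) (sym (β-μ j<q)) (ℕ.∸-monoʳ-< μj<μsj (ℕ.<⇒≤ (μ< sj<q))))
          (μ-point j<q))
        (μ-lower j<q)
        where
        μj<μsj : μ j < μ (suc j)
        μj<μsj = ℕ.+-monoʳ-< (p + 2) (ℕ.n<1+n j)
      bound : ∀ j (j<q : j < q) → suc (heights j j<q) < q
      bound j j<q = suc-height< _ (μ-point j<q) (lower-fits _ (μ-lower j<q) (letter-fits (μ< j<q)))

  β-avoided : Avoids π (β p q)
  β-avoided (e , increasing , order) = [ upper-impossible , lower-impossible ]′ (side (letter p x<))
    where open βOccurrence e increasing order

-- Recovering the multiplicities

prefixed : List Letter → List Letter → List Signed → List Signed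
prefixed E F R = map upper E ++ (map upper F ++ R)

prefixed-shift : ∀ E X F R → prefixed E (X ++ F) R ≡ prefixed (E ++ X) F R
prefixed-shift E X F R = begin
  map upper E ++ map upper (X ++ F) ++ R           ≡⟨ cong (λ Z → map upper E ++ Z ++ R) (map-++ upper X F) ⟩
  map upper E ++ (map upper X ++ map upper F) ++ R ≡⟨ cong (map upper E ++_) (++-assoc (map upper X) (map upper F) R) ⟩
  map upper E ++ map upper X ++ map upper F ++ R   ≡⟨ sym (++-assoc (map upper E) (map upper X) _) ⟩
  (map upper E ++ map upper X) ++ map upper F ++ R ≡⟨ cong (_++ map upper F ++ R) (sym (map-++ upper E X)) ⟩
  map upper (E ++ X) ++ map upper F ++ R           ∎
  where open ≡-Reasoning

length-prefixed-run : ∀ E a ℓ F R → length (prefixed E (replicate a ℓ ++ F) R) ≡ length E + a + length (map upper F ++ R)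
length-prefixed-run E a ℓ F R = begin
  length (prefixed E (replicate a ℓ ++ F) R)                           ≡⟨ cong length (prefixed-shift E (replicate a ℓ) F R) ⟩
  length (map upper (E ++ replicate a ℓ) ++ map upper F ++ R)          ≡⟨ length-++ (map upper (E ++ replicate a ℓ)) ⟩
  length (map upper (E ++ replicate a ℓ)) + length (map upper F ++ R)  ≡⟨ cong (_+ length (map upper F ++ R)) prefix-length ⟩
  length E + a + length (map upper F ++ R)                             ∎
  where
  open ≡-Reasoning
  prefix-length : length (map upper (E ++ replicate a ℓ)) ≡ length E + a
  prefix-length = trans (length-map upper (E ++ replicate a ℓ)) (trans (length-++ E) (cong (_+_ (length E)) (length-replicate a)))

!-prefix : ∀ E F R {v} → v < length E → prefixed E F R ! v ≡ upper (lookupOr (lowCell 0) E v)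
!-prefix E F R {v} v< = trans (lookupOr-++ˡ _ (map upper E) _ (subst (v <_) (sym (length-map upper E)) v<))
  (lookupOr-map upper (lowCell 0) E v)

!-shift : ∀ E F R i → prefixed E F R ! (length E + i) ≡ (map upper F ++ R) ! i
!-shift E F R i = trans (cong (λ k → prefixed E F R ! (k + i)) (sym (length-map upper E)))
  (lookupOr-++ʳ _ (map upper E) _ i)

!-run : ∀ a ℓ F R {i} → i < a → (map upper (replicate a ℓ ++ F) ++ R) ! i ≡ upper ℓ
!-run (suc a) ℓ F R {zero} _ = refl
!-run (suc a) ℓ F R {suc i} (s≤s i<a) = !-run a ℓ F R i<a

!-after-run : ∀ a ℓ F R → (map upper (replicate a ℓ ++ F) ++ R) ! a ≡ (map upper F ++ R) ! 0
!-after-run zero ℓ F R = refl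
!-after-run (suc a) ℓ F R = !-after-run a ℓ F R

module Injectivity (n : ℕ) where

  open IsStrictTotalOrder <ₛ-isStrictTotalOrder using (irrefl; asym)

  BelowPreserved : List Signed → List Signed → Set
  BelowPreserved W W' = ∀ {u x} → u < n → x < n → Below W u x → Below W' u x

  record SameStandardisation (W W' : List Signed) : Set where
    field
      length-W  : length W ≡ n
      length-W' : length W' ≡ n
      preserved : BelowPreserved W W'
      reflected : BelowPreserved W' W

  open SameStandardisation

  SameStandardisation-sym : ∀ {W W'} → SameStandardisation W W' → SameStandardisation W' W
  SameStandardisation-sym same = record
    { length-W = length-W' same ; length-W' = length-W same ; preserved = reflected same ; reflected = preserved same }

  run-end-visible : ∀ {W W' u x ℓ} → u < x → x < n → W ! u ≡ upper ℓ → W' ! u ≡ upper ℓ → W' ! x ≡ upper ℓ →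
    (upper ℓ <ₛ W ! x ⊎ ∃[ v ] v < x × W ! v ≡ W' ! v × W ! x <ₛ W ! v × W' ! v <ₛ upper ℓ) →
    ¬ BelowPreserved W W'
  run-end-visible {W} {W'} {u} {x} u<x x<n Wu W'u W'x (inj₁ ℓ<Wx) preserved
    with preserved (ℕ.<-trans u<x x<n) x<n (inj₁ (subst (_<ₛ W ! x) (sym Wu) ℓ<Wx))
  ... | inj₁ W'u<W'x = irrefl (trans W'u (sym W'x)) W'u<W'x
  ... | inj₂ (_ , x<u) = ℕ.<-asym u<x x<u
  run-end-visible {W} {W'} {u} {x} u<x x<n Wu W'u W'x (inj₂ (v , v<x , Wv≡W'v , Wx<Wv , W'v<ℓ)) preserved
    with preserved x<n (ℕ.<-trans v<x x<n) (inj₁ Wx<Wv)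
  ... | inj₁ W'x<W'v = asym (subst (_<ₛ W' ! v) W'x W'x<W'v) W'v<ℓ
  ... | inj₂ (W'x≡W'v , _) = irrefl (trans (sym W'x≡W'v) W'x) W'v<ℓ

  next-after-run : ∀ E ℓ ls cs R → Multiplicities ls cs → All IsLower R → 0 < length (map upper (inflate ls cs) ++ R) →
    RunEndMarked (_∈ E) ℓ (following ls nothing) →
    upper ℓ <ₛ (map upper (inflate ls cs) ++ R) ! 0 ⊎ ∃[ g ] g ∈ E × (map upper (inflate ls cs) ++ R) ! 0 <ₛ upper g × g <ᵥ ℓ
  next-after-run E ℓ [] cs (lower r ∷ R) _ _ _ (g , g∈E , g<ℓ) = inj₂ (g , g∈E , ₁∼₂ , g<ℓ)
  next-after-run E ℓ [] cs (upper _ ∷ R) _ (() ∷ _) _ _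
  next-after-run E ℓ (ℓ₂ ∷ ls) cs R valid _ _ marked with inflate-head ℓ₂ ls cs valid
  ... | F , eq rewrite eq with marked
  ...   | inj₁ ℓ<ℓ₂ = inj₁ (₂∼₂ ℓ<ℓ₂)
  ...   | inj₂ (g , g∈E , ℓ₂<g , g<ℓ) = inj₂ (g , g∈E , ₂∼₂ ℓ₂<g , g<ℓ)

  longer-run-impossible : ∀ E ℓ {a a'} ls {cs cs' R R'} → 0 < a → a < a' → Multiplicities ls cs → All IsLower R →
    SameStandardisation (prefixed E (replicate a ℓ ++ inflate ls cs) R) (prefixed E (replicate a' ℓ ++ inflate ls cs') R') →
    ¬ RunEndMarked (_∈ E) ℓ (following ls nothing)
  longer-run-impossible E ℓ {suc a} {a'} ls {cs} {cs'} {R} {R'} _ a<a' valid lower-R same marked =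
    run-end-visible {W} {W'} u<x x<n W-u W'-u W'-x next (preserved same)
    where
    F = inflate ls cs
    F' = inflate ls cs'
    W = prefixed E (replicate (suc a) ℓ ++ F) R
    W' = prefixed E (replicate a' ℓ ++ F') R'
    u x : ℕ
    u = length E + a
    x = length E + suc a
    u<x : u < x
    u<x = ℕ.+-monoʳ-< (length E) (ℕ.n<1+n a)
    x<n : x < n
    x<n = subst (x <_) (trans (sym (length-prefixed-run E a' ℓ F' R')) (length-W' same))
      (ℕ.<-≤-trans (ℕ.+-monoʳ-< (length E) a<a') (ℕ.m≤m+n (length E + a') _))
    W-u : W ! u ≡ upper ℓ
    W-u = trans (!-shift E _ R a) (!-run (suc a) ℓ F R (ℕ.n<1+n a))
    W'-u : W' ! u ≡ upper ℓ
    W'-u = trans (!-shift E _ R' a) (!-run a' ℓ F' R' (ℕ.<-trans (ℕ.n<1+n a) a<a'))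
    W'-x : W' ! x ≡ upper ℓ
    W'-x = trans (!-shift E _ R' (suc a)) (!-run a' ℓ F' R' a<a')
    W-x : W ! x ≡ (map upper F ++ R) ! 0
    W-x = trans (!-shift E _ R (suc a)) (!-after-run (suc a) ℓ F R)
    rest-nonempty : 0 < length (map upper F ++ R)
    rest-nonempty = ℕ.+-cancelˡ-< x 0 _ (subst₂ _<_ (sym (ℕ.+-identityʳ x))
      (trans (sym (length-W same)) (length-prefixed-run E (suc a) ℓ F R)) x<n)
    next : upper ℓ <ₛ W ! x ⊎ ∃[ v ] v < x × W ! v ≡ W' ! v × W ! x <ₛ W ! v × W' ! v <ₛ upper ℓ
    next with next-after-run E ℓ ls cs R valid lower-R rest-nonempty marked
    ... | inj₁ ℓ<next = inj₁ (subst (upper ℓ <ₛ_) (sym W-x) ℓ<next)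
    ... | inj₂ (g , g∈E , next<g , g<ℓ) with lookupOr-index (lowCell 0) E g∈E
    ...   | v , v<E , E-v = inj₂ (v , ℕ.<-≤-trans v<E (ℕ.m≤m+n (length E) (suc a)) ,
              trans W-v (sym W'-v) , subst₂ _<ₛ_ (sym W-x) (sym W-v) next<g , subst (_<ₛ upper ℓ) (sym W'-v) (₂∼₂ g<ℓ))
      where
      W-v : W ! v ≡ upper g
      W-v = trans (!-prefix E _ R v<E) (cong upper E-v)
      W'-v : W' ! v ≡ upper g
      W'-v = trans (!-prefix E _ R' v<E) (cong upper E-v)

  seen-after : ∀ {E : List Letter} {ℓ} X → ℓ ∈ X → ∀ {g} → g ≡ ℓ ⊎ g ∈ E → g ∈ E ++ X
  seen-after {E} X ℓ∈X (inj₁ refl) = ∈-++⁺ʳ E ℓ∈X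
  seen-after X ℓ∈X (inj₂ g∈E) = ∈-++⁺ˡ g∈E

  runs-determined : ∀ E ls {cs cs' R R'} → RunEndsMarked (_∈ E) ls nothing → Multiplicities ls cs → Multiplicities ls cs' →
    All IsLower R → All IsLower R' →
    SameStandardisation (prefixed E (inflate ls cs) R) (prefixed E (inflate ls cs') R') → cs ≡ cs'
  runs-determined E [] {[]} {[]} _ _ _ _ _ _ = refl
  runs-determined E [] {_ ∷ _} _ (() , _) _ _ _ _
  runs-determined E [] {[]} {_ ∷ _} _ _ (() , _) _ _ _
  runs-determined E (ℓ ∷ ls) {cs} {cs'} {R} {R'} (marked , marks) valid valid' lower-R lower-R' same with isCell? ℓ
  ... | no _ = runs-determined (E ++ ℓ ∷ []) ls (RunEndsMarked-mono ls nothing (seen-after (ℓ ∷ []) (here refl)) marks)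
    valid valid' lower-R lower-R'
    (subst₂ SameStandardisation (prefixed-shift E (ℓ ∷ []) (inflate ls cs) R) (prefixed-shift E (ℓ ∷ []) (inflate ls cs') R') same)
  runs-determined E (ℓ ∷ ls) {c ∷ cs} {c' ∷ cs'} {R} {R'} (marked , marks) (len , 0<c ∷ pos) (len' , 0<c' ∷ pos')
    lower-R lower-R' same | yes isc with ℕ.<-cmp c c'
  ... | tri< c<c' _ _ = ⊥-elim (longer-run-impossible E ℓ ls 0<c c<c' (ℕ.suc-injective len , pos) lower-R same (marked isc))
  ... | tri> _ _ c'<c = ⊥-elim (longer-run-impossible E ℓ ls 0<c' c'<c (ℕ.suc-injective len' , pos') lower-R'
          (SameStandardisation-sym same) (marked isc))
  ... | tri≈ _ refl _ = cong (c ∷_) (runs-determined (E ++ replicate c ℓ) ls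
          (RunEndsMarked-mono ls nothing (seen-after (replicate c ℓ) (ℓ∈replicate c 0<c)) marks)
          (ℕ.suc-injective len , pos) (ℕ.suc-injective len' , pos') lower-R lower-R'
          (subst₂ SameStandardisation (prefixed-shift E (replicate c ℓ) (inflate ls cs) R)
            (prefixed-shift E (replicate c ℓ) (inflate ls cs') R') same))
    where
    ℓ∈replicate : ∀ m → 0 < m → ℓ ∈ replicate m ℓ
    ℓ∈replicate (suc m) _ = here refl


swap-injective : ∀ {a b : Signed} → swap a ≡ swap b → a ≡ b
swap-injective {a} {b} eq = trans (sym (swap-involutive a)) (trans (cong swap eq) (swap-involutive b))

flipWord : List Signed → List Signed
flipWord W = map swap (reverse W)

swap-<ₛ : ∀ a b → swap a <ₛ swap b → b <ₛ a
swap-<ₛ (upper a) (upper b) (₁∼₁ b<a) = ₂∼₂ b<a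
swap-<ₛ (upper a) (lower b) ₁∼₂ = ₁∼₂
swap-<ₛ (lower a) (lower b) (₂∼₂ a<b) = ₁∼₁ a<b

swap-<ₛ⁻ : ∀ a b → b <ₛ a → swap a <ₛ swap b
swap-<ₛ⁻ (upper a) (upper b) (₂∼₂ b<a) = ₁∼₁ b<a
swap-<ₛ⁻ (upper a) (lower b) ₁∼₂ = ₁∼₂
swap-<ₛ⁻ (lower a) (lower b) (₁∼₁ a<b) = ₂∼₂ a<b

flipWord-! : ∀ W {i} → i < length W → flipWord W ! i ≡ swap (W ! (length W ∸ suc i))
flipWord-! W {i} i< = begin
  lookupOr (upper (lowCell 0)) (map swap (reverse W)) i   ≡⟨ lookupOr-default _ (swap (upper (lowCell 0))) (map swap (reverse W))
                                                               (subst (i <_) (sym (trans (length-map swap (reverse W)) (length-reverse W))) i<) ⟩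
  lookupOr (swap (upper (lowCell 0))) (map swap (reverse W)) i ≡⟨ lookupOr-map swap _ (reverse W) i ⟩
  swap (lookupOr (upper (lowCell 0)) (reverse W) i)       ≡⟨ cong swap (lookupOr-reverse _ W i<) ⟩
  swap (W ! (length W ∸ suc i))                            ∎
  where open ≡-Reasoning

length-flipWord : ∀ W → length (flipWord W) ≡ length W
length-flipWord W = trans (length-map swap (reverse W)) (length-reverse W)

flipWord-word : ∀ K p q cx cy → flipWord (word K p q cx cy) ≡ word K q p cy cx
flipWord-word K p q cx cy = begin
  map swap (reverse (map upper X ++ map lower (reverse Y)))
    ≡⟨ cong (map swap) (reverse-++ (map upper X) (map lower (reverse Y))) ⟩
  map swap (reverse (map lower (reverse Y)) ++ reverse (map upper X))
    ≡⟨ map-++ swap (reverse (map lower (reverse Y))) _ ⟩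
  map swap (reverse (map lower (reverse Y))) ++ map swap (reverse (map upper X))
    ≡⟨ cong₂ _++_ (cong (map swap) (trans (sym (reverse-map lower (reverse Y))) (cong (map lower) (reverse-involutive Y))))
                  (cong (map swap) (sym (reverse-map upper X))) ⟩
  map swap (map lower Y) ++ map swap (map upper (reverse X))
    ≡⟨ cong₂ _++_ (sym (map-∘ Y)) (sym (map-∘ (reverse X))) ⟩
  map upper Y ++ map lower (reverse X)
    ∎
  where
  open ≡-Reasoning
  X = inflate (skeleton K p) cx
  Y = inflate (skeleton K q) cy

module _ {n : ℕ} where
  open Injectivity n

  BelowPreserved-flip : ∀ {W W'} → length W ≡ n → length W' ≡ n → BelowPreserved W W' →
    BelowPreserved (flipWord W) (flipWord W')
  BelowPreserved-flip {W} {W'} refl len' preserved {u'} {x'} u'<n x'<n below = back (preserved u<n x<n (forth below))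
    where
    x u : ℕ
    x = length W ∸ suc u'
    u = length W ∸ suc x'
    x<n : x < length W
    x<n = ℕ.∸-monoʳ-< {o = 0} (s≤s z≤n) u'<n
    u<n : u < length W
    u<n = ℕ.∸-monoʳ-< {o = 0} (s≤s z≤n) x'<n
    flip-u' : ∀ V → length V ≡ length W → flipWord V ! u' ≡ swap (V ! x)
    flip-u' V e = trans (flipWord-! V (subst (u' <_) (sym e) u'<n)) (cong (λ k → swap (V ! (k ∸ suc u'))) e)
    flip-x' : ∀ V → length V ≡ length W → flipWord V ! x' ≡ swap (V ! u)
    flip-x' V e = trans (flipWord-! V (subst (x' <_) (sym e) x'<n)) (cong (λ k → swap (V ! (k ∸ suc x'))) e)
    forth : Below (flipWord W) u' x' → Below W u x
    forth (inj₁ lt) = inj₁ (swap-<ₛ (W ! x) (W ! u) (subst₂ _<ₛ_ (flip-u' W refl) (flip-x' W refl) lt))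
    forth (inj₂ (eq , x'<u')) =
      inj₂ (swap-injective (trans (sym (flip-x' W refl)) (trans (sym eq) (flip-u' W refl))) ,
            ℕ.∸-monoʳ-< (s≤s x'<u') u'<n)
    back : Below W' u x → Below (flipWord W') u' x'
    back (inj₁ lt) = inj₁ (subst₂ _<ₛ_ (sym (flip-u' W' len')) (sym (flip-x' W' len')) (swap-<ₛ⁻ (W' ! x) (W' ! u) lt))
    back (inj₂ (eq , x<u)) =
      inj₂ (trans (flip-u' W' len') (trans (cong swap (sym eq)) (sym (flip-x' W' len'))) ,
            ℕ.≤-pred (ℕ.∸-cancelʳ-< {suc u'} {suc x'} {length W} x<u))

  SameStandardisation-flip : ∀ {W W'} → SameStandardisation W W' → SameStandardisation (flipWord W) (flipWord W')
  SameStandardisation-flip {W} {W'} same = record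
    { length-W = trans (length-flipWord W) (length-W same)
    ; length-W' = trans (length-flipWord W') (length-W' same)
    ; preserved = BelowPreserved-flip {W} {W'} (length-W same) (length-W' same) (preserved same)
    ; reflected = BelowPreserved-flip {W'} {W} (length-W' same) (length-W same) (reflected same)
    }
    where open SameStandardisation

module _ {n : ℕ} where
  open Injectivity n

  std : List Signed → Vec (Fin n) n
  std W = Standardise.standardisation W n

  std-preserves-Below : ∀ W W' → std W ≡ std W' → BelowPreserved W W'
  std-preserves-Below W W' eq {u} {x} u<n x<n below =
    subst₂ (Below W') (Fin.toℕ-fromℕ< u<n) (Fin.toℕ-fromℕ< x<n)
      (Standardise.standardisation-<⁻ W' n
        (subst (λ σ → toℕ (lookup σ (fromℕ< u<n)) < toℕ (lookup σ (fromℕ< x<n))) eq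
          (Standardise.standardisation-< W n
            (subst₂ (Below W) (sym (Fin.toℕ-fromℕ< u<n)) (sym (Fin.toℕ-fromℕ< x<n)) below))))

  std-≡⇒SameStandardisation : ∀ {W W'} → length W ≡ n → length W' ≡ n → std W ≡ std W' → SameStandardisation W W'
  std-≡⇒SameStandardisation {W} {W'} len len' eq = record
    { length-W = len ; length-W' = len'
    ; preserved = std-preserves-Below W W' eq ; reflected = std-preserves-Below W' W (sym eq) }

  word-injective : ∀ {K p q cx cy cx' cy'} → 0 < K →
    Multiplicities (skeleton K p) cx → Multiplicities (skeleton K p) cx' → Multiplicities (skeleton K q) cy → Multiplicities (skeleton K q) cy' →
    length (word K p q cx cy) ≡ n → length (word K p q cx' cy') ≡ n →
    std (word K p q cx cy) ≡ std (word K p q cx' cy') → cx ≡ cx' × cy ≡ cy'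
  word-injective {K} {p} {q} {cx} {cy} {cx'} {cy'} 0<K valid-x valid-x' valid-y valid-y' len len' eq =
    runs-determined [] (skeleton K p) (skeleton-runEndsMarked _ K p 0<K) valid-x valid-x' lowers lowers same ,
    -- flipping turns the lower sides of the words into their upper sides
    runs-determined [] (skeleton K q) (skeleton-runEndsMarked _ K q 0<K) valid-y valid-y' lowers lowers
      (subst₂ SameStandardisation (flipWord-word K p q cx cy) (flipWord-word K p q cx' cy') (SameStandardisation-flip same))
    where
    same : SameStandardisation (word K p q cx cy) (word K p q cx' cy')
    same = std-≡⇒SameStandardisation len len' eq
    lowers : ∀ {xs} → All IsLower (map lower xs)
    lowers = All.map⁺ (All.universal (λ _ → tt) _)

-- Polynomials

fromℕ : ℕ → ℚ
fromℕ a = + a / 1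

fromℕ-normal : ∀ a → fromℕ a ≡ mkℚ (+ a) 0 (Coprime.sym (1-coprimeTo a))
fromℕ-normal a = ℚ.normalize-coprime (Coprime.sym (1-coprimeTo a))

fromℕ-+ : ∀ a b → fromℕ a ℚ.+ fromℕ b ≡ fromℕ (a + b)
fromℕ-+ a b rewrite fromℕ-normal a | fromℕ-normal b =
  cong (_/ 1) (trans (cong₂ ℤ._+_ (ℤ.*-identityʳ (+ a)) (ℤ.*-identityʳ (+ b))) (sym (ℤ.pos-+ a b)))

fromℕ-* : ∀ a b → fromℕ a ℚ.* fromℕ b ≡ fromℕ (a * b)
fromℕ-* a b rewrite fromℕ-normal a | fromℕ-normal b = cong (_/ 1) (sym (ℤ.pos-* a b))

fromℕ-mono-≤ : ∀ {a b} → a ≤ b → fromℕ a ℚ.≤ fromℕ b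
fromℕ-mono-≤ {a} {b} a≤b rewrite fromℕ-normal a | fromℕ-normal b =
  *≤* (subst₂ ℤ._≤_ (sym (ℤ.*-identityʳ (+ a))) (sym (ℤ.*-identityʳ (+ b))) (ℤ.+≤+ a≤b))

fromℕ-cancel-≤ : ∀ {a b} → fromℕ a ℚ.≤ fromℕ b → a ≤ b
fromℕ-cancel-≤ {a} {b} le rewrite fromℕ-normal a | fromℕ-normal b with le
... | *≤* le′ = ℤ.drop‿+≤+ (subst₂ ℤ._≤_ (ℤ.*-identityʳ (+ a)) (ℤ.*-identityʳ (+ b)) le′)

∣fromℕ∣ : ∀ a → ∣ fromℕ a ∣ ≡ fromℕ a
∣fromℕ∣ a = ℚ.0≤p⇒∣p∣≡p (fromℕ-mono-≤ {0} {a} z≤n)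

∣p∣≤∣↥p∣ : ∀ c → ∣ c ∣ ℚ.≤ fromℕ ℤ.∣ ↥ c ∣
∣p∣≤∣↥p∣ c@(mkℚ a d-1 _) rewrite fromℕ-normal ℤ.∣ a ∣ =
  *≤* (subst₂ ℤ._≤_ (sym (ℤ.*-identityʳ (+ ℤ.∣ a ∣))) (ℤ.pos-* ℤ.∣ a ∣ (suc d-1))
    (ℤ.+≤+ (subst (_≤ ℤ.∣ a ∣ * suc d-1) (ℕ.*-identityʳ ℤ.∣ a ∣) (ℕ.*-monoʳ-≤ ℤ.∣ a ∣ (s≤s z≤n)))))

numeratorSum : List ℚ → ℕ
numeratorSum [] = 0
numeratorSum (c ∷ cs) = ℤ.∣ ↥ c ∣ + numeratorSum cs

eval-∷-constant : ∀ c cs n → (∀ n → eval cs n ≡ ℚ.0ℚ) → eval (c ∷ cs) n ≡ c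
eval-∷-constant c cs n cs≡0 =
  trans (cong (c ℚ.+_) (trans (cong (fromℕ n ℚ.*_) (cs≡0 n)) (ℚ.*-zeroʳ (fromℕ n)))) (ℚ.+-identityʳ c)

eval-degree?-nothing : ∀ P → degree? P ≡ nothing → ∀ n → eval P n ≡ ℚ.0ℚ
eval-degree?-nothing [] _ n = refl
eval-degree?-nothing (c ∷ cs) deg n with degree? cs in eq
eval-degree?-nothing (c ∷ cs) () n | just _
... | nothing with c ℚ.≟ ℚ.0ℚ
...   | yes refl = eval-∷-constant ℚ.0ℚ cs n (eval-degree?-nothing cs eq)
eval-degree?-nothing (c ∷ cs) () n | nothing | no _

horner-step-≤ : ∀ b B n d → 1 ≤ n → b + n * (B * n ^ d) ≤ (b + B) * (n * n ^ d)
horner-step-≤ b B n d 1≤n = begin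
  b + n * (B * n ^ d)                  ≤⟨ ℕ.+-monoˡ-≤ _ (subst (_≤ b * n ^ suc d) (ℕ.*-identityʳ b) (ℕ.*-monoʳ-≤ b 1≤n^1+d)) ⟩
  b * (n * n ^ d) + n * (B * n ^ d)    ≡⟨ cong (λ z → b * (n * n ^ d) + z) (*-CS.x∙yz≈y∙xz n B (n ^ d)) ⟩
  b * (n * n ^ d) + B * (n * n ^ d)    ≡⟨ sym (ℕ.*-distribʳ-+ (n * n ^ d) b B) ⟩
  (b + B) * (n * n ^ d)                ∎
  where
  open ℕ.≤-Reasoning
  1≤n^1+d : 1 ≤ n ^ suc d
  1≤n^1+d = ℕ.m^n>0 n {{>-nonZero 1≤n}} (suc d)

∣eval∣≤ : ∀ P n → 1 ≤ n → ∣ eval P n ∣ ℚ.≤ fromℕ (numeratorSum P * n ^ degree P)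
∣eval∣≤ [] n _ = ℚ.≤-reflexive (ℚ.0≤p⇒∣p∣≡p (ℚ.≤-refl {ℚ.0ℚ}))
∣eval∣≤ (c ∷ cs) n 1≤n with degree? cs in eq | ∣eval∣≤ cs n 1≤n
... | just d | ih = begin
  ∣ c ℚ.+ fromℕ n ℚ.* eval cs n ∣                        ≤⟨ ℚ.∣p+q∣≤∣p∣+∣q∣ c _ ⟩
  ∣ c ∣ ℚ.+ ∣ fromℕ n ℚ.* eval cs n ∣                    ≡⟨ cong (∣ c ∣ ℚ.+_) (trans (ℚ.∣p*q∣≡∣p∣*∣q∣ (fromℕ n) _) (cong (ℚ._* ∣ eval cs n ∣) (∣fromℕ∣ n))) ⟩
  ∣ c ∣ ℚ.+ fromℕ n ℚ.* ∣ eval cs n ∣                    ≤⟨ ℚ.+-mono-≤ (∣p∣≤∣↥p∣ c) (ℚ.*-monoˡ-≤-nonNeg (fromℕ n) {{ℚ.nonNegative (fromℕ-mono-≤ {0} {n} z≤n)}} ih) ⟩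
  fromℕ b ℚ.+ fromℕ n ℚ.* fromℕ (numeratorSum cs * n ^ d) ≡⟨ cong (fromℕ b ℚ.+_) (fromℕ-* n _) ⟩
  fromℕ b ℚ.+ fromℕ (n * (numeratorSum cs * n ^ d))     ≡⟨ fromℕ-+ b _ ⟩
  fromℕ (b + n * (numeratorSum cs * n ^ d))             ≤⟨ fromℕ-mono-≤ (horner-step-≤ b (numeratorSum cs) n d 1≤n) ⟩
  fromℕ ((b + numeratorSum cs) * (n * n ^ d))           ∎
  where
  open ℚ.≤-Reasoning
  b = ℤ.∣ ↥ c ∣
... | nothing | _ with c ℚ.≟ ℚ.0ℚ
...   | yes refl = subst (ℚ._≤ fromℕ ((ℤ.∣ ↥ ℚ.0ℚ ∣ + numeratorSum cs) * 1))
                     (sym (trans (cong ∣_∣ (eval-∷-constant ℚ.0ℚ cs n (eval-degree?-nothing cs eq))) (∣fromℕ∣ 0)))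
                     (fromℕ-mono-≤ {0} {(ℤ.∣ ↥ ℚ.0ℚ ∣ + numeratorSum cs) * 1} z≤n)
...   | no _ = subst (ℚ._≤ fromℕ ((ℤ.∣ ↥ c ∣ + numeratorSum cs) * 1))
                 (sym (cong ∣_∣ (eval-∷-constant c cs n (eval-degree?-nothing cs eq))))
                 (ℚ.≤-trans (∣p∣≤∣↥p∣ c) (fromℕ-mono-≤ (subst (ℤ.∣ ↥ c ∣ ≤_) (sym (ℕ.*-identityʳ _)) (ℕ.m≤m+n _ _))))

size≤polynomial : ∀ P n {k} → 1 ≤ n → eval P n ≡ + k / 1 → k ≤ numeratorSum P * n ^ degree P
size≤polynomial P n {k} 1≤n eval≡k =
  fromℕ-cancel-≤ (subst (ℚ._≤ _) (trans (cong ℚ.∣_∣ eval≡k) (∣fromℕ∣ k)) (∣eval∣≤ P n 1≤n))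

-- The family of permutations and the theorem

digits : ∀ m D → Fin (m ^ D) → List ℕ
digits m zero _ = []
digits m (suc D) i = suc (toℕ (proj₁ (remQuot {m} (m ^ D) i))) ∷ digits m D (proj₂ (remQuot {m} (m ^ D) i))

digits-injective : ∀ m D {i j} → digits m D i ≡ digits m D j → i ≡ j
digits-injective m zero {Fin.zero} {Fin.zero} _ = refl
digits-injective m (suc D) {i} {j} eq = begin
  i                                                             ≡⟨ sym (Fin.combine-remQuot {n = m} (m ^ D) i) ⟩
  combine {m} {m ^ D} (proj₁ (remQuot {m} (m ^ D) i)) (proj₂ (remQuot {m} (m ^ D) i)) ≡⟨ cong₂ (combine {m} {m ^ D})
     (Fin.toℕ-injective (ℕ.suc-injective (proj₁ (∷-injective eq)))) (digits-injective m D (proj₂ (∷-injective eq))) ⟩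
  combine {m} {m ^ D} (proj₁ (remQuot {m} (m ^ D) j)) (proj₂ (remQuot {m} (m ^ D) j)) ≡⟨ Fin.combine-remQuot {n = m} (m ^ D) j ⟩
  j                                                             ∎
  where open ≡-Reasoning

length-digits : ∀ m D i → length (digits m D i) ≡ D
length-digits m zero i = refl
length-digits m (suc D) i = cong suc (length-digits m D _)

digits-positive : ∀ m D i → All (1 ≤_) (digits m D i)
digits-positive m zero i = []
digits-positive m (suc D) i = s≤s z≤n ∷ digits-positive m D _

sum-digits≤ : ∀ m D i → sum (digits m D i) ≤ D * m
sum-digits≤ m zero i = z≤n
sum-digits≤ m (suc D) i = ℕ.+-mono-≤ (Fin.toℕ<n _) (sum-digits≤ m D _)

module Family (K p q : ℕ) (0<K : 0 < K) (1≤p+q : 1 ≤ p + q) (m : ℕ) where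

  X D upperCells lowerCells points n : ℕ
  X = suc K * (p + q)
  D = X ∸ 1
  upperCells = cellCount (skeleton K p)
  lowerCells = cellCount (skeleton K q)
  points = pointCount (skeleton K p) + pointCount (skeleton K q)
  n = points + (D * m + 1)

  D+1≡X : D + 1 ≡ X
  D+1≡X = ℕ.m∸n+n≡m (ℕ.*-mono-≤ {1} {suc K} (s≤s z≤n) 1≤p+q)

  upperCells+lowerCells≡X : upperCells + lowerCells ≡ X
  upperCells+lowerCells≡X = trans (cong₂ _+_ (cellCount-skeleton K p) (cellCount-skeleton K q)) (sym (ℕ.*-distribˡ-+ (suc K) p q))

  -- D counts in 1..m taken from the digits of i, and a last count making the total D * m + 1.
  multiplicities : Fin (m ^ D) → List ℕ
  multiplicities i = digits m D i ++ (D * m + 1 ∸ sum (digits m D i)) ∷ []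

  upperRuns lowerRuns : Fin (m ^ D) → List ℕ
  upperRuns i = take upperCells (multiplicities i)
  lowerRuns i = drop upperCells (multiplicities i)

  length-multiplicities : ∀ i → length (multiplicities i) ≡ X
  length-multiplicities i = trans (length-++ (digits m D i)) (trans (cong (_+ 1) (length-digits m D i)) D+1≡X)

  sum-multiplicities : ∀ i → sum (multiplicities i) ≡ D * m + 1
  sum-multiplicities i = trans (sum-++ (digits m D i) _)
    (trans (cong (_+_ (sum (digits m D i))) (ℕ.+-identityʳ _))
      (ℕ.m+[n∸m]≡n (ℕ.≤-trans (sum-digits≤ m D i) (ℕ.m≤m+n (D * m) 1))))

  multiplicities-positive : ∀ i → All (1 ≤_) (multiplicities i)
  multiplicities-positive i = All.++⁺ (digits-positive m D i) (filler-positive ∷ [])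
    where
    filler-positive : 1 ≤ D * m + 1 ∸ sum (digits m D i)
    filler-positive = ℕ.m+n≤o⇒m≤o∸n 1 (subst (_≤ D * m + 1) (ℕ.+-comm (sum (digits m D i)) 1)
      (ℕ.+-monoˡ-≤ 1 (sum-digits≤ m D i)))

  upperRuns-multiplicities : ∀ i → Multiplicities (skeleton K p) (upperRuns i)
  upperRuns-multiplicities i = trans (length-take upperCells (multiplicities i))
      (ℕ.m≤n⇒m⊓n≡m (subst (upperCells ≤_) (trans upperCells+lowerCells≡X (sym (length-multiplicities i))) (ℕ.m≤m+n _ _)))
    , All.take⁺ upperCells (multiplicities-positive i)

  lowerRuns-multiplicities : ∀ i → Multiplicities (skeleton K q) (lowerRuns i)
  lowerRuns-multiplicities i = trans (length-drop upperCells (multiplicities i))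
      (trans (cong (_∸ upperCells) (trans (length-multiplicities i) (sym upperCells+lowerCells≡X))) (ℕ.m+n∸m≡n upperCells lowerCells))
    , All.drop⁺ upperCells (multiplicities-positive i)

  W : Fin (m ^ D) → List Signed
  W i = word K p q (upperRuns i) (lowerRuns i)

  length-W : ∀ i → length (W i) ≡ n
  length-W i = begin
    length (W i)
      ≡⟨ length-word K p q (upperRuns i) (lowerRuns i) ⟩
    length (inflate (skeleton K p) (upperRuns i)) + length (inflate (skeleton K q) (lowerRuns i))
      ≡⟨ cong₂ _+_ (length-inflate (skeleton K p) (upperRuns i) (proj₁ (upperRuns-multiplicities i)))
                   (length-inflate (skeleton K q) (lowerRuns i) (proj₁ (lowerRuns-multiplicities i))) ⟩
    (pointCount (skeleton K p) + sum (upperRuns i)) + (pointCount (skeleton K q) + sum (lowerRuns i))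
      ≡⟨ +-CS.interchange (pointCount (skeleton K p)) (sum (upperRuns i)) (pointCount (skeleton K q)) (sum (lowerRuns i)) ⟩
    points + (sum (upperRuns i) + sum (lowerRuns i))
      ≡⟨ cong (_+_ points) (trans (sym (sum-++ (upperRuns i) (lowerRuns i)))
                                 (trans (cong sum (take++drop≡id upperCells (multiplicities i))) (sum-multiplicities i))) ⟩
    n ∎
    where open ≡-Reasoning

  perm : Fin (m ^ D) → Vec (Fin n) n
  perm i = std (W i)

  perm-injective : ∀ {i j} → perm i ≡ perm j → i ≡ j
  perm-injective {i} {j} eq with word-injective {K = K} {p} {q} {upperRuns i} {lowerRuns i} {upperRuns j} {lowerRuns j} 0<K (upperRuns-multiplicities i) (upperRuns-multiplicities j) (lowerRuns-multiplicities i) (lowerRuns-multiplicities j) (length-W i) (length-W j) eq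
  ... | upper≡ , lower≡ = digits-injective m D (∷ʳ-injectiveˡ (digits m D i) (digits m D j) (begin
    multiplicities i                    ≡⟨ sym (take++drop≡id upperCells (multiplicities i)) ⟩
    upperRuns i ++ lowerRuns i                  ≡⟨ cong₂ _++_ upper≡ lower≡ ⟩
    upperRuns j ++ lowerRuns j                  ≡⟨ take++drop≡id upperCells (multiplicities j) ⟩
    multiplicities j                    ∎))
    where open ≡-Reasoning

  perm-avoids : ∀ i → IsPerm (perm i) × Avoids (perm i) (α (suc (suc K))) × Avoids (perm i) (β p q)
  perm-avoids i = Standardise.standardisation-isPerm (W i) n , α-avoided , β-avoided
    where
    open Avoidance 0<K (W i)
      (λ i<j j<n → lookupOr-AllPairs _ (word-sorted K p q (upperRuns i) (lowerRuns i)) i<j (subst (_ <_) (sym (length-W i)) j<n))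
      (λ i<n → All.lookup (word-fits K p q (upperRuns i) (lowerRuns i)) (lookupOr-∈ _ (W i) (subst (_ <_) (sym (length-W i)) i<n)))
      (perm i) (Standardise.standardisation-<⁻ (W i) n)

  m^D≤ : ∀ L → Enumerates (α (suc (suc K))) (β p q) L → m ^ D ≤ length L
  m^D≤ L (_ , enumerates) = Fin.injective⇒≤ {f = position} position-injective
    where
    member : ∀ i → perm i ∈ L
    member i = Equivalence.from (enumerates (perm i)) (perm-avoids i)
    position : Fin (m ^ D) → Fin (length L)
    position i = index (member i)
    position-injective : ∀ {i j} → position i ≡ position j → i ≡ j
    position-injective {i} {j} eq = perm-injective (trans (Any.lookup-index (member i))
      (trans (cong (List.lookup L) eq) (sym (Any.lookup-index (member j)))))

  n≤Cm : 1 ≤ m → n ≤ (points + D + 1) * m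
  n≤Cm 1≤m = begin
    points + (D * m + 1)         ≤⟨ ℕ.+-mono-≤ (ℕ.m≤m*n points m {{>-nonZero 1≤m}}) (ℕ.+-monoʳ-≤ (D * m) 1≤m) ⟩
    points * m + (D * m + m)     ≡⟨ cong (_+_ (points * m)) (cong (_+_ (D * m)) (sym (ℕ.*-identityˡ m))) ⟩
    points * m + (D * m + 1 * m) ≡⟨ cong (_+_ (points * m)) (sym (ℕ.*-distribʳ-+ m D 1)) ⟩
    points * m + (D + 1) * m     ≡⟨ sym (ℕ.*-distribʳ-+ m points (D + 1)) ⟩
    (points + (D + 1)) * m       ≡⟨ cong (_* m) (sym (ℕ.+-assoc points D 1)) ⟩
    (points + D + 1) * m         ∎
    where open ℕ.≤-Reasoning

  m^D≤polynomial : 1 ≤ m → ∀ P L → Enumerates (α (suc (suc K))) (β p q) L → eval P n ≡ + length L / 1 →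
    m ^ D ≤ numeratorSum P * ((points + D + 1) * m) ^ degree P
  m^D≤polynomial 1≤m P L enumerates eval≡ = begin
    m ^ D                                               ≤⟨ m^D≤ L enumerates ⟩
    length L                                            ≤⟨ size≤polynomial P n 1≤n eval≡ ⟩
    numeratorSum P * n ^ degree P                       ≤⟨ ℕ.*-monoʳ-≤ (numeratorSum P) (ℕ.^-monoˡ-≤ (degree P) (n≤Cm 1≤m)) ⟩
    numeratorSum P * ((points + D + 1) * m) ^ degree P  ∎
    where
    open ℕ.≤-Reasoning
    1≤n : 1 ≤ n
    1≤n = ℕ.≤-trans (ℕ.m≤n+m 1 (D * m)) (ℕ.m≤n+m (D * m + 1) points)

power-beats-polynomial : ∀ B C m {d D} → d < D → 0 < C * m → B * C ^ (D ∸ 1) < m → B * (C * m) ^ d < m ^ D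
power-beats-polynomial B C m {d} {suc D} (s≤s d≤D) 0<Cm BC^D<m = begin-strict
  B * (C * m) ^ d        ≤⟨ ℕ.*-monoʳ-≤ B (ℕ.^-monoʳ-≤ (C * m) {{>-nonZero 0<Cm}} d≤D) ⟩
  B * (C * m) ^ D        ≡⟨ cong (B *_) (*-^-distrib C m D) ⟩
  B * (C ^ D * m ^ D)    ≡⟨ sym (ℕ.*-assoc B (C ^ D) (m ^ D)) ⟩
  B * C ^ D * m ^ D      <⟨ ℕ.*-monoˡ-< (m ^ D) {{ℕ.m^n≢0 m D {{>-nonZero (ℕ.≤-<-trans z≤n BC^D<m)}}}} BC^D<m ⟩
  m * m ^ D              ∎
  where open ℕ.≤-Reasoning

corollary4p4 : (r p q : ℕ) → 3 ≤ r → 1 ≤ p + q →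
    (P : List ℚ) (N : ℕ) →
    (∀ n → N ≤ n → ∃ λ (L : List (Vec (Fin n) n)) →
        Enumerates (α r) (β p q) L × eval P n ≡ + length L / 1) →
    (r ∸ 1) * ((p + q + 2) ∸ 2) ∸ 1 ≤ degree P
corollary4p4 (suc (suc (suc K))) p q (s≤s (s≤s (s≤s z≤n))) 1≤p+q P N enumerations =
  subst (λ s → suc (suc K) * s ∸ 1 ≤ degree P) (sym (ℕ.m+n∸n≡m (p + q) 2)) (ℕ.≮⇒≥ degree<D-impossible)
  where
  open Family (suc K) p q (s≤s z≤n) 1≤p+q 0 using (D; points)   -- neither depends on the last argument
  B C m : ℕ
  B = numeratorSum P
  C = points + D + 1
  m = suc (B * C ^ (D ∸ 1) + N)
  module Fm = Family (suc K) p q (s≤s z≤n) 1≤p+q m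
  N≤n : 0 < D → N ≤ Fm.n
  N≤n 0<D = ℕ.≤-trans (ℕ.m≤n+m N (suc (B * C ^ (D ∸ 1))))
    (ℕ.≤-trans (ℕ.m≤n*m m D {{>-nonZero 0<D}}) (ℕ.≤-trans (ℕ.m≤m+n (D * m) 1) (ℕ.m≤n+m _ points)))
  degree<D-impossible : ¬ degree P < D
  degree<D-impossible d<D with enumerations Fm.n (N≤n (ℕ.≤-<-trans z≤n d<D))
  ... | L , enumerates , eval≡ =
    ℕ.<⇒≱ (power-beats-polynomial B C m d<D (ℕ.*-mono-≤ (ℕ.m≤n+m 1 (points + D)) (s≤s z≤n)) (s≤s (ℕ.m≤m+n _ N)))
          (Fm.m^D≤polynomial (s≤s z≤n) P L enumerates eval≡)
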